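{- Let $n \geq 3$ and let $G_n$ be the $n\times n$ square grid graph, whose bandwidth is $n$. Then the minimal number of edges that must be deleted from $G_n$ in order to obtain a subgraph of bandwidth at most $n-1$ is exactly $2$. Moreover, there exist two edges of $G_n$ sharing a common endpoint whose deletion yields a subgraph of bandwidth at most $n-1$, and there also exist two edges of $G_n$ with no common endpoint whose deletion yields a subgraph of bandwidth at most $n-1$.
   Context: All graphs are finite, simple and undirected. A vertex numbering of a graph $G=(V,E)$ is a bijection $\nu: V \to \{1,2,\dots,|V|\}$. For an edge $e=uv$, its length induced by $\nu$ is $|\nu(u)-\nu(v)|$. The bandwidth of $\nu$ is the largest induced edge length (0 if $E=\emptyset$), and the bandwidth of $G$ is the minimum bandwidth over all vertex numberings of $G$. The square grid $G_n$ has vertex set $\{1,\dots,n\}\times\{1,\dots,n\}$, with two vertices adjacent iff their Euclidean distance is $1$; its bandwidth is $n$ for $n\ge 2$. -}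

module Defs where

open import Data.Nat using (ℕ; _*_; _≤_; ∣_-_∣)
open import Data.Fin using (Fin; toℕ)
open import Data.Product using (_×_; _,_; Σ; ∃; proj₁; proj₂)
open import Data.Sum using (_⊎_)
open import Data.List using (List; _∷_; [])
open import Data.List.Membership.Propositional using (_∈_)
open import Relation.Binary.PropositionalEquality using (_≡_)
open import Relation.Nullary using (¬_)
open import Function.Bundles using (_⤖_; Bijection)

-- Vertices of the n×n square grid G_n (coordinates 0..n-1 instead of 1..n).
Vertex : ℕ → Set
Vertex n = Fin n × Fin n

GridAdj : ∀ {n} → Vertex n → Vertex n → Set
GridAdj (i , j) (i' , j') =
  (i ≡ i' × ∣ toℕ j - toℕ j' ∣ ≡ 1) ⊎ (j ≡ j' × ∣ toℕ i - toℕ i' ∣ ≡ 1)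

-- An edge of G_n, given by an (oriented) pair of adjacent endpoints.
Edge : ℕ → Set
Edge n = Σ (Vertex n × Vertex n) λ p → GridAdj (proj₁ p) (proj₂ p)

src tgt : ∀ {n} → Edge n → Vertex n
src e = proj₁ (proj₁ e)
tgt e = proj₂ (proj₁ e)

Joins : ∀ {n} → Edge n → Vertex n → Vertex n → Set
Joins e u v = (src e ≡ u × tgt e ≡ v) ⊎ (src e ≡ v × tgt e ≡ u)

SameEdge : ∀ {n} → Edge n → Edge n → Set
SameEdge e f = Joins e (src f) (tgt f)

Deleted : ∀ {n} → List (Edge n) → Vertex n → Vertex n → Set
Deleted F u v = ∃ λ e → e ∈ F × Joins e u v

-- A vertex numbering of G_n: a bijection V → {1,…,n²}, realised as Fin (n*n)
-- (i.e. shifted to {0,…,n²-1}; edge lengths are unaffected).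
Numbering : ℕ → Set
Numbering n = Vertex n ⤖ Fin (n * n)

len : ∀ {n} → Numbering n → Vertex n → Vertex n → ℕ
len ν u v = ∣ toℕ (Bijection.to ν u) - toℕ (Bijection.to ν v) ∣

NumberingBW≤ : ∀ {n} → List (Edge n) → Numbering n → ℕ → Set
NumberingBW≤ {n} F ν k =
  (u v : Vertex n) → GridAdj u v → ¬ Deleted F u v → len ν u v ≤ k

BandwidthDel≤ : (n : ℕ) → List (Edge n) → ℕ → Set
BandwidthDel≤ n F k = ∃ λ (ν : Numbering n) → NumberingBW≤ F ν k

ShareEndpoint : ∀ {n} → Edge n → Edge n → Set
ShareEndpoint e f =
  (src e ≡ src f) ⊎ (src e ≡ tgt f) ⊎ (tgt e ≡ src f) ⊎ (tgt e ≡ tgt f)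

-- Let g number G_n minus one edge e with bandwidth m = n - 1, and let t be the first
-- threshold at which the labels below t meet every column (otherwise transpose).  Some column c₀
-- holds at most one of them.  Every column is crossed by a vertical edge from a label below t to one
-- above it; unless the crossing is e, the upper label lies in [t, t + m).  These m labels cannot
-- serve all n columns, so one crossing is e and the others fill the window.  The same argument for
-- the labels M - g gives a second cut through e.  Counting in each column the vertices below the
-- first cut and above the second gives two 1-Lipschitz profiles, each at most 1 next to its sparse
-- column; as the cuts are disjoint and miss at most one vertex per column and none next to the column
-- of e, the profiles sum to at least m everywhere and to n around that column, which is impossible.
--
-- In the anti-diagonal numbering the only edges longer than m join the diagonals m - 1,
-- m and m + 1.  Moving the corner (m , 0) back to the start of diagonal m - 2, and the opposite corner
-- (0 , m) or the neighbour (m , 1) forward to the end of diagonal m + 2, shortens all of them; at the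
-- moved vertices only the edge (m , 0)-(m , 1) and one edge at the second vertex are then too long,
-- and these two are deleted.

module Submission where

open import Data.Nat
open import Data.Nat.Properties
open import Data.Nat.Tactic.RingSolver using (solve-∀)
open import Data.Fin using (Fin; toℕ; fromℕ<; fromℕ; remQuot; combine; punchOut)
open import Data.Fin.Patterns using (0F; 1F)
open import Data.Fin.Properties
  using (toℕ<n; toℕ-fromℕ<; toℕ-fromℕ; toℕ-injective; any?; punchOut-injective; combine-remQuot; <⇒notInjective)
  renaming (_≟_ to _≟ᶠ_)
open import Data.Product using (Σ; ∃; ∃₂; _×_; _,_; proj₁; proj₂; swap; uncurry)
open import Data.Sum using (_⊎_; inj₁; inj₂; [_,_]′)
open import Data.Empty using (⊥; ⊥-elim)
open import Data.List using (List; []; _∷_; length)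
open import Data.List.Membership.Propositional using (_∈_)
open import Data.List.Relation.Unary.Any using (here; there)
open import Function using (_∘_)
open import Function.Bundles using (Bijection; mk⤖)
open import Function.Definitions using (Injective; Surjective)
open import Relation.Nullary using (¬_; Dec; yes; no; contradiction; ¬?)
open import Relation.Nullary.Decidable using (decidable-stable; _×-dec_; _⊎-dec_; map′)
open import Relation.Unary using (Decidable)
open import Relation.Binary using (DecidableEquality; tri<; tri≈; tri>)
open import Relation.Binary.PropositionalEquality hiding ([_])
open import Defs

[m+m]∸[a+b]≡[m∸a]+[m∸b] : ∀ {m a b} → a ≤ m → b ≤ m → (m + m) ∸ (a + b) ≡ (m ∸ a) + (m ∸ b)
[m+m]∸[a+b]≡[m∸a]+[m∸b] {m} {a} {b} a≤m b≤m = begin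
  (m + m) ∸ (a + b)     ≡⟨ sym (∸-+-assoc (m + m) a b) ⟩
  (m + m) ∸ a ∸ b       ≡⟨ cong (_∸ b) (+-∸-comm m a≤m) ⟩
  (m ∸ a) + m ∸ b       ≡⟨ +-∸-assoc (m ∸ a) b≤m ⟩
  (m ∸ a) + (m ∸ b)     ∎
  where open ≡-Reasoning

∣n-1+n∣≡1 : ∀ n → ∣ n - suc n ∣ ≡ 1
∣n-1+n∣≡1 zero = refl
∣n-1+n∣≡1 (suc n) = ∣n-1+n∣≡1 n

∣m-n∣≡1⇒m≡1+n⊎n≡1+m : ∀ {m n} → ∣ m - n ∣ ≡ 1 → m ≡ suc n ⊎ n ≡ suc m
∣m-n∣≡1⇒m≡1+n⊎n≡1+m {zero} {suc zero} _ = inj₂ refl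
∣m-n∣≡1⇒m≡1+n⊎n≡1+m {suc zero} {zero} _ = inj₁ refl
∣m-n∣≡1⇒m≡1+n⊎n≡1+m {suc m} {suc n} eq with ∣m-n∣≡1⇒m≡1+n⊎n≡1+m {m} {n} eq
... | inj₁ m≡n+1 = inj₁ (cong suc m≡n+1)
... | inj₂ n≡m+1 = inj₂ (cong suc n≡m+1)

Close : ℕ → ℕ → ℕ → Set
Close m x y = y ≤ x + m × x ≤ y + m

∣-∣≤⇒close : ∀ {m x y} → ∣ x - y ∣ ≤ m → Close m x y
∣-∣≤⇒close {m} {x} {y} ∣x-y∣≤m =
  ≤-trans (m≤n+∣n-m∣ y x) (+-monoʳ-≤ x ∣x-y∣≤m) , ≤-trans (m≤n+∣m-n∣ x y) (+-monoʳ-≤ y ∣x-y∣≤m)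

close⇒∣-∣≤ : ∀ {m x y} → Close m x y → ∣ x - y ∣ ≤ m
close⇒∣-∣≤ {m} {x} {y} (y≤x+m , x≤y+m) with ∣m-n∣≡[m∸n]∨[n∸m] x y
... | inj₁ eq = subst (_≤ m) (sym eq) (m≤n+o⇒m∸n≤o x y x≤y+m)
... | inj₂ eq = subst (_≤ m) (sym eq) (m≤n+o⇒m∸n≤o y x y≤x+m)

∸-close : ∀ {m M x y} → x ≤ M → y ≤ M → Close m x y → Close m (M ∸ x) (M ∸ y)
∸-close {m} {M} {x} {y} x≤M y≤M (y≤x+m , x≤y+m) = flip-under x≤M x≤y+m , flip-under y≤M y≤x+m
  where
  flip-under : ∀ {a b} → a ≤ M → a ≤ b + m → M ∸ b ≤ (M ∸ a) + m
  flip-under {a} {b} a≤M a≤b+m = m≤n+o⇒m∸n≤o M b (begin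
    M                   ≡⟨ sym (m∸n+n≡m a≤M) ⟩
    (M ∸ a) + a         ≤⟨ +-monoʳ-≤ (M ∸ a) a≤b+m ⟩
    (M ∸ a) + (b + m)   ≡⟨ +-comm (M ∸ a) (b + m) ⟩
    (b + m) + (M ∸ a)   ≡⟨ +-assoc b m (M ∸ a) ⟩
    b + (m + (M ∸ a))   ≡⟨ cong (b +_) (+-comm m (M ∸ a)) ⟩
    b + ((M ∸ a) + m)   ∎)
    where open ≤-Reasoning

private
  below-suc : ∀ {k} {X : ℕ → Set} → (∀ i → i < suc k → X i) → ∀ i → i < k → X i
  below-suc f i i<k = f i (m<n⇒m<1+n i<k)

module _ {P : ℕ → Set} (P? : Decidable P) where

  count : ℕ → ℕ
  count zero = 0
  count (suc k) with P? k
  ... | yes _ = suc (count k)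
  ... | no _ = count k

  count≡0 : ∀ k → (∀ i → i < k → ¬ P i) → count k ≡ 0
  count≡0 zero _ = refl
  count≡0 (suc k) none with P? k
  ... | yes p = contradiction p (none k (n<1+n k))
  ... | no _ = count≡0 k (below-suc none)

  count≤1 : ∀ k → (∀ i i' → i < k → i' < k → P i → P i' → i ≡ i') → count k ≤ 1
  count≤1 zero _ = z≤n
  count≤1 (suc k) unique with P? k
  ... | yes p = ≤-reflexive (cong suc (count≡0 k (λ i i<k pi → <⇒≢ i<k (unique i k (m<n⇒m<1+n i<k) (n<1+n k) pi p))))
  ... | no _ = count≤1 k (λ i i' i<k i'<k → unique i i' (m<n⇒m<1+n i<k) (m<n⇒m<1+n i'<k))

  crossing : ∀ {a} b → a ≤ b → P a → ¬ P b → ∃ λ x → a ≤ x × x < b × P x × ¬ P (suc x)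
  crossing zero z≤n pa ¬pb = contradiction pa ¬pb
  crossing {a} (suc b) a≤b+1 pa ¬pb+1 = step (P? b)
    where
    a≤b : a ≤ b
    a≤b = s≤s⁻¹ (≤∧≢⇒< a≤b+1 λ { refl → ¬pb+1 pa })
    step : Dec (P b) → ∃ λ x → a ≤ x × x < suc b × P x × ¬ P (suc x)
    step (yes pb) = b , a≤b , n<1+n b , pb , ¬pb+1
    step (no ¬pb) with crossing b a≤b pa ¬pb
    ... | x , a≤x , x<b , px , ¬px+1 = x , a≤x , m<n⇒m<1+n x<b , px , ¬px+1

module _ {P Q : ℕ → Set} (P? : Decidable P) (Q? : Decidable Q) where

  count-mono : ∀ k → (∀ i → i < k → P i → Q i) → count P? k ≤ count Q? k
  count-mono zero _ = z≤n
  count-mono (suc k) P⇒Q with P? k | Q? k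
  ... | yes _ | yes _ = s≤s (count-mono k (below-suc P⇒Q))
  ... | yes p | no ¬q = contradiction (P⇒Q k (n<1+n k) p) ¬q
  ... | no _  | yes _ = m≤n⇒m≤1+n (count-mono k (below-suc P⇒Q))
  ... | no _  | no _  = count-mono k (below-suc P⇒Q)

  count-mono-except : ∀ k r → (∀ i → i < k → i ≢ r → P i → Q i) → count P? k ≤ suc (count Q? k)
  count-mono-except zero r _ = z≤n
  count-mono-except (suc k) r P⇒Q with P? k | Q? k
  ... | yes _ | yes _ = s≤s (count-mono-except k r (below-suc P⇒Q))
  ... | yes p | no ¬q = s≤s (count-mono k (λ i i<k → P⇒Q i (m<n⇒m<1+n i<k) λ { refl → <⇒≢ i<k (sym k≡r) }))
    where
    k≡r : k ≡ r
    k≡r with k ≟ r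
    ... | yes k≡r = k≡r
    ... | no k≢r = contradiction (P⇒Q k (n<1+n k) k≢r p) ¬q
  ... | no _  | yes _ = m≤n⇒m≤1+n (count-mono-except k r (below-suc P⇒Q))
  ... | no _  | no _  = count-mono-except k r (below-suc P⇒Q)

  count-cover : ∀ k → (∀ i → i < k → P i ⊎ Q i) → k ≤ count P? k + count Q? k
  count-cover zero _ = z≤n
  count-cover (suc k) P∪Q with P? k | Q? k
  ... | yes _ | yes _ = s≤s (≤-trans (count-cover k (below-suc P∪Q)) (+-monoʳ-≤ (count P? k) (n≤1+n _)))
  ... | yes _ | no _  = s≤s (count-cover k (below-suc P∪Q))
  ... | no _  | yes _ = ≤-trans (s≤s (count-cover k (below-suc P∪Q))) (≤-reflexive (sym (+-suc (count P? k) (count Q? k))))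
  ... | no ¬p | no ¬q = ⊥-elim ([ ¬p , ¬q ]′ (P∪Q k (n<1+n k)))

  count-cover-except : ∀ k r → (∀ i → i < k → i ≢ r → P i ⊎ Q i) → k ≤ suc (count P? k + count Q? k)
  count-cover-except zero r _ = z≤n
  count-cover-except (suc k) r P∪Q with P? k | Q? k
  ... | yes _ | yes _ = s≤s (≤-trans (count-cover-except k r (below-suc P∪Q)) (s≤s (+-monoʳ-≤ (count P? k) (n≤1+n _))))
  ... | yes _ | no _  = s≤s (count-cover-except k r (below-suc P∪Q))
  ... | no _  | yes _ = ≤-trans (s≤s (count-cover-except k r (below-suc P∪Q)))
      (≤-reflexive (sym (cong suc (+-suc (count P? k) (count Q? k)))))
  ... | no ¬p | no ¬q = s≤s (count-cover k (λ i i<k → P∪Q i (m<n⇒m<1+n i<k) λ { refl → <⇒≢ i<k (sym k≡r) }))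
    where
    k≡r : k ≡ r
    k≡r with k ≟ r
    ... | yes k≡r = k≡r
    ... | no k≢r = ⊥-elim ([ ¬p , ¬q ]′ (P∪Q k (n<1+n k) k≢r))

-- x lies in [A - m, A), stated without truncated subtraction.
InWindow : ℕ → ℕ → ℕ → Set
InWindow m A x = A ≤ x + m × x < A

window-pigeonhole : ∀ {m A} (val : Fin (suc m) → ℕ) →
  (∀ k → InWindow m A (val k)) → Injective _≡_ _≡_ val → ⊥
window-pigeonhole {m} {A} val in-window val-injective = <⇒notInjective (n<1+n m) slot-injective
  where
  slot< : ∀ k → (val k + m) ∸ A < m
  slot< k = subst ((val k + m) ∸ A <_) (m+n∸m≡n A m)
    (∸-monoˡ-< (+-monoˡ-< m (proj₂ (in-window k))) (proj₁ (in-window k)))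
  slot : Fin (suc m) → Fin m
  slot k = fromℕ< (slot< k)
  slot-injective : Injective _≡_ _≡_ slot
  slot-injective {i} {j} eq = val-injective (+-cancelʳ-≡ m _ _
    (∸-cancelʳ-≡ (proj₁ (in-window i)) (proj₁ (in-window j))
      (trans (sym (toℕ-fromℕ< _)) (trans (cong toℕ eq) (toℕ-fromℕ< _)))))

bounded-¬∀∃ : ∀ {R : ℕ → ℕ → Set} → (∀ a b → Dec (R a b)) → ∀ {k l} →
  ¬ (∀ a → a < k → ∃ λ b → b < l × R a b) → ∃ λ a → a < k × ∀ b → b < l → ¬ R a b
bounded-¬∀∃ R? {k} {l} ¬∀∃ with anyUpTo? (λ a → ¬? (anyUpTo? (R? a) l)) k
... | yes (a , a<k , ¬∃) = a , a<k , λ b b<l r → ¬∃ (b , b<l , r)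
... | no ¬∃∀ = contradiction (λ a a<k → decidable-stable (anyUpTo? (R? a) l) λ ¬∃ → ¬∃∀ (a , a<k , ¬∃)) ¬∀∃

-- Lipschitz profiles

Near : ℕ → ℕ → Set
Near k c = k ≡ c ⊎ suc k ≡ c ⊎ k ≡ suc c

near-sym : ∀ {k c} → Near k c → Near c k
near-sym (inj₁ refl) = inj₁ refl
near-sym (inj₂ (inj₁ refl)) = inj₂ (inj₂ refl)
near-sym (inj₂ (inj₂ refl)) = inj₂ (inj₁ refl)

near-one : ∀ {c} → c ≤ 2 → Near 1 c
near-one z≤n = inj₂ (inj₂ refl)
near-one (s≤s z≤n) = inj₁ refl
near-one (s≤s (s≤s z≤n)) = inj₂ (inj₁ refl)

Lipschitz : ℕ → (ℕ → ℕ) → Set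
Lipschitz n h = ∀ j → suc j < n → h j ≤ suc (h (suc j)) × h (suc j) ≤ suc (h j)

SmallNear : ℕ → (ℕ → ℕ) → ℕ → Set
SmallNear n h c = ∀ k → k < n → Near k c → h k ≤ 1

module _ {n h} (lip : Lipschitz n h) where

  lipschitz-up : ∀ a d → a + d < n → h (a + d) ≤ h a + d
  lipschitz-up a zero a<n rewrite +-identityʳ a | +-identityʳ (h a) = ≤-refl
  lipschitz-up a (suc d) a+d<n rewrite +-suc a d | +-suc (h a) d =
    ≤-trans (proj₂ (lip (a + d) a+d<n)) (s≤s (lipschitz-up a d (<-trans (n<1+n _) a+d<n)))

  lipschitz-down : ∀ a d → a + d < n → h a ≤ h (a + d) + d
  lipschitz-down a zero a<n rewrite +-identityʳ a | +-identityʳ (h a) = ≤-refl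
  lipschitz-down a (suc d) a+d<n rewrite +-suc a d | +-suc (h (suc (a + d))) d =
    ≤-trans (lipschitz-down a d (<-trans (n<1+n _) a+d<n)) (+-monoˡ-≤ d (proj₁ (lip (a + d) a+d<n)))

  module _ {c} (small : SmallNear n h c) where

    small-near⇒bound-right : ∀ {q} → c < q → q < n → h q + c ≤ q
    small-near⇒bound-right {q} c<q q<n with m≤n⇒∃[o]m+o≡n c<q
    ... | d , refl = begin
      h (suc c + d) + c     ≤⟨ +-monoˡ-≤ c (lipschitz-up (suc c) d q<n) ⟩
      h (suc c) + d + c     ≤⟨ +-monoˡ-≤ c (+-monoˡ-≤ d (small (suc c) (≤-<-trans (m≤m+n _ d) q<n) (inj₂ (inj₂ refl)))) ⟩
      1 + d + c             ≡⟨ cong suc (+-comm d c) ⟩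
      suc c + d             ∎
      where open ≤-Reasoning

    small-near⇒bound-left : ∀ {q} → c < n → q < c → h q + q ≤ c
    small-near⇒bound-left {q} c<n q<c with m≤n⇒∃[o]m+o≡n q<c
    ... | d , refl = begin
      h q + q               ≤⟨ +-monoˡ-≤ q (lipschitz-down q d (≤-<-trans (n≤1+n _) c<n)) ⟩
      h (q + d) + d + q     ≤⟨ +-monoˡ-≤ q (+-monoˡ-≤ d (small (q + d) (≤-<-trans (n≤1+n _) c<n) (inj₂ (inj₁ refl)))) ⟩
      1 + d + q             ≡⟨ cong suc (+-comm d q) ⟩
      suc q + d             ∎
      where open ≤-Reasoning

record ProfilePair (m : ℕ) (h H : ℕ → ℕ) (c c₀ c₁ : ℕ) : Set where
  field
    2≤m : 2 ≤ m
    c<n : c < suc m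
    c₀<n : c₀ < suc m
    c₁<n : c₁ < suc m
    c₀≢c : c₀ ≢ c
    c₁≢c : c₁ ≢ c
    lip-h : Lipschitz (suc m) h
    lip-H : Lipschitz (suc m) H
    small-h : SmallNear (suc m) h c₀
    small-H : SmallNear (suc m) H c₁
    cover : ∀ q → q < suc m → m ≤ h q + H q
    cover-near : ∀ k → k < suc m → Near k c → suc m ≤ h k + H k

swap-profiles : ∀ {m h H c c₀ c₁} → ProfilePair m h H c c₀ c₁ → ProfilePair m H h c c₁ c₀
swap-profiles {m} {h} {H} P = record
  { 2≤m = 2≤m ; c<n = c<n ; c₀<n = c₁<n ; c₁<n = c₀<n ; c₀≢c = c₁≢c ; c₁≢c = c₀≢c
  ; lip-h = lip-H ; lip-H = lip-h ; small-h = small-H ; small-H = small-h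
  ; cover = λ q q<n → subst (m ≤_) (+-comm (h q) (H q)) (cover q q<n)
  ; cover-near = λ k k<n near → subst (suc m ≤_) (+-comm (h k) (H k)) (cover-near k k<n near) }
  where open ProfilePair P

module _ {m h H c c₀ c₁} (P : ProfilePair m h H c c₀ c₁) where
  open ProfilePair P
  open ≤-Reasoning

  private
    m<m : m < m → ⊥
    m<m = <-irrefl refl

  -- When c₀ = c₁ the profiles force m ≤ 2, and then column 1 is near every column.
  profiles-coincide : c₀ ≡ c₁ → ⊥
  profiles-coincide refl = m<m (begin-strict
    m                 <⟨ cover-near 1 1<n (near-one (s≤s⁻¹ (≤-trans c<n (s≤s m≤2)))) ⟩
    h 1 + H 1         ≤⟨ +-mono-≤ (small-h 1 1<n (near-one c₀≤2)) (small-H 1 1<n (near-one c₀≤2)) ⟩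
    2                 ≤⟨ 2≤m ⟩
    m                 ∎)
    where
    m≤2 : m ≤ 2
    m≤2 = ≤-trans (cover c₀ c₀<n)
            (+-mono-≤ (small-h c₀ c₀<n (inj₁ refl)) (small-H c₀ c₀<n (inj₁ refl)))
    c₀≤2 : c₀ ≤ 2
    c₀≤2 = ≤-trans (s≤s⁻¹ c₀<n) m≤2
    1<n : 1 < suc m
    1<n = s≤s (≤-trans (s≤s z≤n) 2≤m)

  profiles-between : c₀ < c → c < c₁ → ⊥
  profiles-between c₀<c c<c₁ = m<m (+-cancelˡ-< c m m (begin-strict
    c + m                     <⟨ +-monoʳ-< c (cover-near c c<n (inj₁ refl)) ⟩
    c + (h c + H c)           ≡⟨ rearrange c (h c) (H c) ⟩
    h c + (H c + c)           ≤⟨ +-monoˡ-≤ (H c + c) (m≤m+n (h c) c₀) ⟩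
    (h c + c₀) + (H c + c)    ≤⟨ +-mono-≤ (small-near⇒bound-right lip-h small-h c₀<c c<n)
                                          (≤-trans (small-near⇒bound-left lip-H small-H c₁<n c<c₁) (s≤s⁻¹ c₁<n)) ⟩
    c + m                     ∎))
    where
    rearrange : ∀ c x y → c + (x + y) ≡ x + (y + c)
    rearrange = solve-∀

  profiles-left : c₀ < c₁ → c₁ < c → ⊥
  profiles-left c₀<c₁ c₁<c = [ far , adjacent ]′ (m≤n⇒m<n∨m≡n c₁<c)
    where
    sum≤ : h c₁ + H c₁ ≤ c₁ + 1
    sum≤ = +-mono-≤ (≤-trans (m≤m+n (h c₁) c₀) (small-near⇒bound-right lip-h small-h c₀<c₁ c₁<n))
                    (small-H c₁ c₁<n (inj₁ refl))
    adjacent : suc c₁ ≡ c → ⊥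
    adjacent c₁+1≡c = m<m (begin-strict
      m                 <⟨ cover-near c₁ c₁<n (inj₂ (inj₁ c₁+1≡c)) ⟩
      h c₁ + H c₁       ≤⟨ sum≤ ⟩
      c₁ + 1            ≡⟨ trans (+-comm c₁ 1) c₁+1≡c ⟩
      c                 ≤⟨ s≤s⁻¹ c<n ⟩
      m                 ∎)
    far : suc c₁ < c → ⊥
    far c₁+1<c = m<m (begin-strict
      m                 ≤⟨ cover c₁ c₁<n ⟩
      h c₁ + H c₁       ≤⟨ sum≤ ⟩
      c₁ + 1            ≡⟨ +-comm c₁ 1 ⟩
      suc c₁            <⟨ c₁+1<c ⟩
      c                 ≤⟨ s≤s⁻¹ c<n ⟩
      m                 ∎)

  profiles-right : c < c₀ → c₀ < c₁ → ⊥
  profiles-right c<c₀ c₀<c₁ = [ far , adjacent ]′ (m≤n⇒m<n∨m≡n c<c₀)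
    where
    bound : h c₀ + H c₀ + c₀ ≤ suc m
    bound = ≤-trans (≤-reflexive (+-assoc (h c₀) (H c₀) c₀))
              (+-mono-≤ (small-h c₀ c₀<n (inj₁ refl))
                        (≤-trans (small-near⇒bound-left lip-H small-H c₁<n c₀<c₁) (s≤s⁻¹ c₁<n)))
    adjacent : suc c ≡ c₀ → ⊥
    adjacent refl = m+1+n≰m (suc m) (≤-trans (+-monoˡ-≤ c₀ (cover-near c₀ c₀<n (inj₂ (inj₂ refl)))) bound)
    far : suc c < c₀ → ⊥
    far c+1<c₀ = m+1+n≰m (suc m) (begin
      suc m + suc c               ≡⟨ sym (+-suc m (suc c)) ⟩
      m + suc (suc c)             ≤⟨ +-monoʳ-≤ m c+1<c₀ ⟩
      m + c₀                      ≤⟨ +-monoˡ-≤ c₀ (cover c₀ c₀<n) ⟩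
      h c₀ + H c₀ + c₀            ≤⟨ bound ⟩
      suc m                       ∎)

  profiles-ordered : c₀ < c₁ → ⊥
  profiles-ordered c₀<c₁ with <-cmp c c₀ | <-cmp c c₁
  ... | tri< c<c₀ _ _ | _              = profiles-right c<c₀ c₀<c₁
  ... | tri≈ _ c≡c₀ _ | _              = c₀≢c (sym c≡c₀)
  ... | tri> _ _ c₀<c | tri< c<c₁ _ _  = profiles-between c₀<c c<c₁
  ... | tri> _ _ _    | tri≈ _ c≡c₁ _  = c₁≢c (sym c≡c₁)
  ... | tri> _ _ _    | tri> _ _ c₁<c  = profiles-left c₀<c₁ c₁<c

profiles-impossible : ∀ {m h H c c₀ c₁} → ProfilePair m h H c c₀ c₁ → ⊥
profiles-impossible {c₀ = c₀} {c₁} P with <-cmp c₀ c₁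
... | tri< c₀<c₁ _ _ = profiles-ordered P c₀<c₁
... | tri≈ _ c₀≡c₁ _ = profiles-coincide P c₀≡c₁
... | tri> _ _ c₁<c₀ = profiles-ordered (swap-profiles P) c₁<c₀

-- Labellings of the grid with one exempt edge

-- vert i j joins (i , j) and (i + 1 , j); horiz i j joins (i , j) and (i , j + 1).
data GridEdge : Set where
  vert horiz : ℕ → ℕ → GridEdge

vert-injective : ∀ {a b c d} → vert a b ≡ vert c d → a ≡ c × b ≡ d
vert-injective refl = refl , refl

horiz-injective : ∀ {a b c d} → horiz a b ≡ horiz c d → a ≡ c × b ≡ d
horiz-injective refl = refl , refl

_≟ᵉ_ : DecidableEquality GridEdge
vert i j ≟ᵉ vert i' j' = map′ (λ (i≡ , j≡) → cong₂ vert i≡ j≡) vert-injective ((i ≟ i') ×-dec (j ≟ j'))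
horiz i j ≟ᵉ horiz i' j' = map′ (λ (i≡ , j≡) → cong₂ horiz i≡ j≡) horiz-injective ((i ≟ i') ×-dec (j ≟ j'))
vert _ _ ≟ᵉ horiz _ _ = no λ ()
horiz _ _ ≟ᵉ vert _ _ = no λ ()

transpose-edge : GridEdge → GridEdge
transpose-edge (vert i j) = horiz j i
transpose-edge (horiz i j) = vert j i

record Banded (m : ℕ) (g : ℕ → ℕ → ℕ) (M : ℕ) (e : GridEdge) : Set where
  field
    injective   : ∀ {i j i' j'} → i < suc m → j < suc m → i' < suc m → j' < suc m →
                  g i j ≡ g i' j' → i ≡ i' × j ≡ j'
    bounded     : ∀ {i j} → i < suc m → j < suc m → g i j ≤ M
    vert-close  : ∀ {i j} → suc i < suc m → j < suc m → e ≢ vert i j → Close m (g i j) (g (suc i) j)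
    horiz-close : ∀ {i j} → i < suc m → suc j < suc m → e ≢ horiz i j → Close m (g i j) (g i (suc j))

Transpose : (ℕ → ℕ → ℕ) → ℕ → ℕ → ℕ
Transpose g i j = g j i

Reverse : ℕ → (ℕ → ℕ → ℕ) → ℕ → ℕ → ℕ
Reverse M g i j = M ∸ g i j

transpose-banded : ∀ {m g M e} → Banded m g M e → Banded m (Transpose g) M (transpose-edge e)
transpose-banded B = record
  { injective   = λ i<n j<n i'<n j'<n eq → swap (injective j<n i<n j'<n i'<n eq)
  ; bounded     = λ i<n j<n → bounded j<n i<n
  ; vert-close  = λ i+1<n j<n e≢ → horiz-close j<n i+1<n (λ eq → e≢ (cong transpose-edge eq))
  ; horiz-close = λ i<n j+1<n e≢ → vert-close j+1<n i<n (λ eq → e≢ (cong transpose-edge eq)) }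
  where open Banded B

reverse-banded : ∀ {m g M e} → Banded m g M e → Banded m (Reverse M g) M e
reverse-banded {m} {g} {M} B = record
  { injective   = λ i<n j<n i'<n j'<n eq → injective i<n j<n i'<n j'<n (∸-cancelˡ-≡ (bounded i<n j<n) (bounded i'<n j'<n) eq)
  ; bounded     = λ {i} {j} _ _ → m∸n≤m M (g i j)
  ; vert-close  = λ i+1<n j<n e≢ → ∸-close (bounded (<-trans (n<1+n _) i+1<n) j<n) (bounded i+1<n j<n)
      (vert-close i+1<n j<n e≢)
  ; horiz-close = λ i<n j+1<n e≢ → ∸-close (bounded i<n (<-trans (n<1+n _) j+1<n)) (bounded i<n j+1<n)
      (horiz-close i<n j+1<n e≢) }
  where open Banded B

MeetsAllColumns : ℕ → (ℕ → ℕ → ℕ) → ℕ → Set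
MeetsAllColumns m g t = ∀ j → j < suc m → ∃ λ i → i < suc m × g i j < t

MeetsAllRows : ℕ → (ℕ → ℕ → ℕ) → ℕ → Set
MeetsAllRows m g = MeetsAllColumns m (Transpose g)

height : ℕ → (ℕ → ℕ → ℕ) → ℕ → ℕ → ℕ
height m g t j = count (λ i → g i j <? t) (suc m)

Endpoints : ℕ → ℕ → ℕ → Set
Endpoints x a b = (a ≡ x × b ≡ suc x) ⊎ (a ≡ suc x × b ≡ x)

endpoints<n : ∀ {n x a b} → Endpoints x a b → suc x < n → a < n × b < n
endpoints<n (inj₁ (refl , refl)) x+1<n = <-trans (n<1+n _) x+1<n , x+1<n
endpoints<n (inj₂ (refl , refl)) x+1<n = x+1<n , <-trans (n<1+n _) x+1<n

endpoints-close : ∀ {m g M e x a b j} → Banded m g M e → Endpoints x a b → suc x < suc m → j < suc m →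
  e ≢ vert x j → Close m (g a j) (g b j)
endpoints-close B (inj₁ (refl , refl)) x+1<n j<n e≢ = Banded.vert-close B x+1<n j<n e≢
endpoints-close B (inj₂ (refl , refl)) x+1<n j<n e≢ = swap (Banded.vert-close B x+1<n j<n e≢)

module _ {m g M e} (B : Banded m g M e) where
  open Banded B

  window-filled : ∀ c A (w : ℕ → ℕ) →
    (∀ j → j < suc m → j ≢ c → w j < suc m × InWindow m A (g (w j) j)) →
    ∀ {i j} → i < suc m → j < suc m → InWindow m A (g i j) → j ≢ c × i ≡ w j
  window-filled c A w filled {i} {j} i<n j<n ij-in =
    decidable-stable (¬? (j ≟ c) ×-dec (i ≟ w j)) λ ¬witness →
      window-pigeonhole val (λ k → in-window (toℕ<n k) (toℕ k ≟ c)) (val-injective ¬witness)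
    where
    value : ∀ k → Dec (k ≡ c) → ℕ
    value k (yes _) = g i j
    value k (no _) = g (w k) k
    val : Fin (suc m) → ℕ
    val k = value (toℕ k) (toℕ k ≟ c)
    in-window : ∀ {k} → k < suc m → ∀ k≟c → InWindow m A (value k k≟c)
    in-window k<n (yes _) = ij-in
    in-window k<n (no k≢c) = proj₂ (filled _ k<n k≢c)
    witness : ∀ {k} → k < suc m → k ≢ c → g i j ≡ g (w k) k → j ≢ c × i ≡ w j
    witness k<n k≢c eq with injective i<n j<n (proj₁ (filled _ k<n k≢c)) k<n eq
    ... | i≡ , refl = k≢c , i≡
    value-injective : ¬ (j ≢ c × i ≡ w j) → ∀ {k k'} → k < suc m → k' < suc m → ∀ k≟c k'≟c →
      value k k≟c ≡ value k' k'≟c → k ≡ k'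
    value-injective _ _ _ (yes k≡c) (yes k'≡c) _ = trans k≡c (sym k'≡c)
    value-injective ¬w _ k'<n (yes _) (no k'≢c) eq = ⊥-elim (¬w (witness k'<n k'≢c eq))
    value-injective ¬w k<n _ (no k≢c) (yes _) eq = ⊥-elim (¬w (witness k<n k≢c (sym eq)))
    value-injective _ k<n k'<n (no k≢c) (no k'≢c) eq =
      proj₂ (injective (proj₁ (filled _ k<n k≢c)) k<n (proj₁ (filled _ k'<n k'≢c)) k'<n eq)
    val-injective : ¬ (j ≢ c × i ≡ w j) → Injective _≡_ _≡_ val
    val-injective ¬w {k} {k'} eq = toℕ-injective (value-injective ¬w (toℕ<n k) (toℕ<n k') (toℕ k ≟ c) (toℕ k' ≟ c) eq)

-- Cuts at a threshold

record ColumnCut (m : ℕ) (g : ℕ → ℕ → ℕ) (e : GridEdge) (t : ℕ) : Set where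
  field
    col row inner outer : ℕ
    col<n : col < suc m
    row+1<n : suc row < suc m
    deleted : e ≡ vert row col
    endpoints : Endpoints row inner outer
    inner-below : g inner col < t
    sparse : ℕ
    sparse<n : sparse < suc m
    sparse≢col : sparse ≢ col
    height-small : SmallNear (suc m) (height m g t) sparse
    height-lipschitz : Lipschitz (suc m) (height m g t)
    rows-near-col : ∀ k → k < suc m → Near k col → ∀ i → i < suc m →
                    (g i k < t → g i col < t) × (g i col < t → g i k < t)
    above-everywhere : ∀ j → j < suc m → ∃ λ i → i < suc m × t ≤ g i j
    top : ℕ → ℕ
    window-above : ∀ {i j} → i < suc m → j < suc m → InWindow m (t + m) (g i j) → j ≢ col × i ≡ top j

module CutConstruction {m g M e} (B : Banded m g M e) (2≤m : 2 ≤ m) (t' : ℕ)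
  (meets : MeetsAllColumns m g (suc t'))
  (¬meets-cols : ¬ MeetsAllColumns m g t') (¬meets-rows : ¬ MeetsAllRows m g t') where
  open Banded B

  t : ℕ
  t = suc t'

  private
    1≤m : 1 ≤ m
    1≤m = ≤-trans (n≤1+n 1) 2≤m

  empty-col : ∃ λ c → c < suc m × ∀ i → i < suc m → ¬ g i c < t'
  empty-col = bounded-¬∀∃ (λ j i → g i j <? t') ¬meets-cols

  c₀ : ℕ
  c₀ = proj₁ empty-col
  c₀<n : c₀ < suc m
  c₀<n = proj₁ (proj₂ empty-col)
  c₀-empty : ∀ i → i < suc m → t' ≤ g i c₀
  c₀-empty i i<n = ≮⇒≥ (proj₂ (proj₂ empty-col) i i<n)

  empty-row : ∃ λ r → r < suc m × ∀ j → j < suc m → ¬ g r j < t'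
  empty-row = bounded-¬∀∃ (λ i j → g i j <? t') ¬meets-rows

  r₀ : ℕ
  r₀ = proj₁ empty-row
  r₀<n : r₀ < suc m
  r₀<n = proj₁ (proj₂ empty-row)
  r₀-empty : ∀ j → j < suc m → t' ≤ g r₀ j
  r₀-empty j j<n = ≮⇒≥ (proj₂ (proj₂ empty-row) j j<n)

  below-t-in-c₀ : ∃ λ i → i < suc m × g i c₀ < t
  below-t-in-c₀ = meets c₀ c₀<n

  v : ℕ
  v = proj₁ below-t-in-c₀
  v<n : v < suc m
  v<n = proj₁ (proj₂ below-t-in-c₀)
  gv≡t' : g v c₀ ≡ t'
  gv≡t' = ≤-antisym (s≤s⁻¹ (proj₂ (proj₂ below-t-in-c₀))) (c₀-empty v v<n)

  labelled-t' : ∀ {i j} → i < suc m → j < suc m → g i j ≡ t' → i ≡ v × j ≡ c₀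
  labelled-t' i<n j<n eq = injective i<n j<n v<n c₀<n (trans eq (sym gv≡t'))

  ≥t'⇒≥t : ∀ {x} → t' ≤ x → x ≢ t' → t ≤ x
  ≥t'⇒≥t t'≤x x≢t' = ≤∧≢⇒< t'≤x (λ eq → x≢t' (sym eq))

  below-t' : ∀ {i j} → i < suc m → j < suc m → j ≢ c₀ → g i j < t → g i j < t'
  below-t' i<n j<n j≢c₀ lt = ≤∧≢⇒< (s≤s⁻¹ lt) (λ eq → j≢c₀ (proj₂ (labelled-t' i<n j<n eq)))

  only-v-below-t-in-c₀ : ∀ {i} → i < suc m → g i c₀ < t → i ≡ v
  only-v-below-t-in-c₀ i<n lt = proj₁ (labelled-t' i<n c₀<n (≤-antisym (s≤s⁻¹ lt) (c₀-empty _ i<n)))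

  other-row : ∃ λ i → i < suc m × i ≢ v
  other-row with v ≟ 0
  ... | yes v≡0 = 1 , s≤s 1≤m , λ 1≡v → 1+n≢0 (trans 1≡v v≡0)
  ... | no v≢0 = 0 , z<s , λ 0≡v → v≢0 (sym 0≡v)

  above-everywhere : ∀ j → j < suc m → ∃ λ i → i < suc m × t ≤ g i j
  above-everywhere j j<n with j ≟ c₀ | other-row
  ... | no j≢c₀ | _ = r₀ , r₀<n , ≥t'⇒≥t (r₀-empty j j<n) (λ eq → j≢c₀ (proj₂ (labelled-t' r₀<n j<n eq)))
  ... | yes refl | i , i<n , i≢v = i , i<n , ≥t'⇒≥t (c₀-empty i i<n) (λ eq → i≢v (proj₁ (labelled-t' i<n c₀<n eq)))

  Crossing : ℕ → ℕ → ℕ → ℕ → Set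
  Crossing j x a b = suc x < suc m × Endpoints x a b × g a j < t × t ≤ g b j

  crossing-in : ∀ j → j < suc m → Σ (ℕ × ℕ × ℕ) λ (x , a , b) → Crossing j x a b
  crossing-in j j<n with meets j j<n | above-everywhere j j<n
  ... | i₁ , i₁<n , below | i₂ , i₂<n , above with <-cmp i₁ i₂
  ...   | tri< i₁<i₂ _ _ with crossing (λ i → g i j <? t) i₂ (<⇒≤ i₁<i₂) below (λ lt → <⇒≱ lt above)
  ...     | x , _ , x<i₂ , below-x , ¬below-x+1 =
            (x , x , suc x) , ≤-<-trans x<i₂ i₂<n , inj₁ (refl , refl) , below-x , ≮⇒≥ ¬below-x+1
  crossing-in j j<n | i₁ , i₁<n , below | i₂ , i₂<n , above | tri≈ _ refl _ = contradiction above (<⇒≱ below)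
  crossing-in j j<n | i₁ , i₁<n , below | i₂ , i₂<n , above | tri> _ _ i₂<i₁
    with crossing (λ i → t ≤? g i j) i₁ (<⇒≤ i₂<i₁) above (<⇒≱ below)
  ... | x , _ , x<i₁ , above-x , ¬above-x+1 =
        (x , suc x , x) , ≤-<-trans x<i₁ i₁<n , inj₂ (refl , refl) , ≰⇒> ¬above-x+1 , above-x

  -- A choice of crossing edge in every column; junk outside the grid.
  crossing-at : ℕ → ℕ × ℕ × ℕ
  crossing-at j with j <? suc m
  ... | yes j<n = proj₁ (crossing-in j j<n)
  ... | no _ = 0 , 0 , 0

  cross-row cross-in cross-out : ℕ → ℕ
  cross-row j = proj₁ (crossing-at j)
  cross-in j = proj₁ (proj₂ (crossing-at j))
  cross-out j = proj₂ (proj₂ (crossing-at j))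

  crossing-at-spec : ∀ {j} → j < suc m → Crossing j (cross-row j) (cross-in j) (cross-out j)
  crossing-at-spec {j} j<n with j <? suc m
  ... | yes j<n' = proj₂ (crossing-in j j<n')
  ... | no j≮n = contradiction j<n j≮n

  module _ {j} (j<n : j < suc m) where

    cross-in<n : cross-in j < suc m
    cross-in<n = proj₁ (endpoints<n (proj₁ (proj₂ (crossing-at-spec j<n))) (proj₁ (crossing-at-spec j<n)))

    cross-out<n : cross-out j < suc m
    cross-out<n = proj₂ (endpoints<n (proj₁ (proj₂ (crossing-at-spec j<n))) (proj₁ (crossing-at-spec j<n)))

    cross-in-below : g (cross-in j) j < t
    cross-in-below = proj₁ (proj₂ (proj₂ (crossing-at-spec j<n)))

    cross-out-above : t ≤ g (cross-out j) j
    cross-out-above = proj₂ (proj₂ (proj₂ (crossing-at-spec j<n)))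

    module _ (e≢ : e ≢ vert (cross-row j) j) where

      cross-close : Close m (g (cross-in j) j) (g (cross-out j) j)
      cross-close = endpoints-close B (proj₁ (proj₂ (crossing-at-spec j<n))) (proj₁ (crossing-at-spec j<n)) j<n e≢

      cross-out-window : InWindow m (t + m) (g (cross-out j) j)
      cross-out-window = +-monoˡ-≤ m cross-out-above , ≤-<-trans (proj₁ cross-close) (+-monoˡ-< m cross-in-below)

      cross-in-window : InWindow m t (g (cross-in j) j)
      cross-in-window = ≤-trans cross-out-above (proj₁ cross-close) , cross-in-below

  no-deleted-crossing : (∀ j → j < suc m → e ≢ vert (cross-row j) j) → ⊥
  no-deleted-crossing none = window-pigeonhole val (λ k → cross-out-window (toℕ<n k) (none _ (toℕ<n k))) val-injective
    where
    val : Fin (suc m) → ℕ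
    val k = g (cross-out (toℕ k)) (toℕ k)
    val-injective : Injective _≡_ _≡_ val
    val-injective {k} {k'} eq =
      toℕ-injective (proj₂ (injective (cross-out<n (toℕ<n k)) (toℕ<n k) (cross-out<n (toℕ<n k')) (toℕ<n k') eq))

  module AtDeletedColumn (c : ℕ) (c<n : c < suc m) (deleted : e ≡ vert (cross-row c) c) where

    off-col : ∀ {j} → j ≢ c → e ≢ vert (cross-row j) j
    off-col j≢c eq = j≢c (proj₂ (vert-injective (trans (sym eq) deleted)))

    not-horiz : ∀ {i j} → e ≢ horiz i j
    not-horiz eq with trans (sym deleted) eq
    ... | ()

    row-close : ∀ {i j j'} → i < suc m → j < suc m → j' < suc m → Near j' j → g i j' ≤ g i j + m
    row-close {i} {j} _ _ _ (inj₁ refl) = m≤m+n (g i j) m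
    row-close i<n j'+1<n _ (inj₂ (inj₁ refl)) = proj₂ (horiz-close i<n j'+1<n not-horiz)
    row-close i<n _ j+1<n (inj₂ (inj₂ refl)) = proj₁ (horiz-close i<n j+1<n not-horiz)

    window-above : ∀ {i j} → i < suc m → j < suc m → InWindow m (t + m) (g i j) → j ≢ c × i ≡ cross-out j
    window-above = window-filled B c (t + m) cross-out
      (λ j j<n j≢c → cross-out<n j<n , cross-out-window j<n (off-col j≢c))

    window-below : ∀ {i j} → i < suc m → j < suc m → InWindow m t (g i j) → j ≢ c × i ≡ cross-in j
    window-below = window-filled B c t cross-in
      (λ j j<n j≢c → cross-in<n j<n , cross-in-window j<n (off-col j≢c))

    leaves-below : ∀ {i j j'} → i < suc m → j < suc m → j' < suc m → Near j' j →
      g i j < t → ¬ g i j' < t → j ≢ c × i ≡ cross-in j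
    leaves-below i<n j<n j'<n near lt ¬lt' = window-below i<n j<n (≤-trans (≮⇒≥ ¬lt') (row-close i<n j<n j'<n near) , lt)

    enters-below : ∀ {i j j'} → i < suc m → j < suc m → j' < suc m → Near j j' →
      g i j' < t → ¬ g i j < t → j ≢ c × i ≡ cross-out j
    enters-below i<n j<n j'<n near lt' ¬lt =
      window-above i<n j<n (+-monoˡ-≤ m (≮⇒≥ ¬lt) , ≤-<-trans (row-close i<n j'<n j<n near) (+-monoˡ-< m lt'))

    rows-near-col : ∀ k → k < suc m → Near k c → ∀ i → i < suc m → (g i k < t → g i c < t) × (g i c < t → g i k < t)
    rows-near-col k k<n near i i<n =
      (λ lt → decidable-stable (g i c <? t) λ ¬lt → proj₁ (enters-below i<n c<n k<n (near-sym near) lt ¬lt) refl) ,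
      (λ lt → decidable-stable (g i k <? t) λ ¬lt → proj₁ (leaves-below i<n c<n k<n near lt ¬lt) refl)

    height-lipschitz : Lipschitz (suc m) (height m g t)
    height-lipschitz j j+1<n =
      count-mono-except (λ i → g i j <? t) (λ i → g i (suc j) <? t) (suc m) (cross-in j)
        (λ i i<n i≢ lt → decidable-stable (g i (suc j) <? t) λ ¬lt →
            i≢ (proj₂ (leaves-below i<n j<n j+1<n (inj₂ (inj₂ refl)) lt ¬lt))) ,
      count-mono-except (λ i → g i (suc j) <? t) (λ i → g i j <? t) (suc m) (cross-in (suc j))
        (λ i i<n i≢ lt → decidable-stable (g i j <? t) λ ¬lt →
            i≢ (proj₂ (leaves-below i<n j+1<n j<n (inj₂ (inj₁ refl)) lt ¬lt)))
      where
      j<n : j < suc m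
      j<n = <-trans (n<1+n j) j+1<n

    c₀≢c : c₀ ≢ c
    c₀≢c = proj₁ (window-below v<n c₀<n (subst (λ x → t ≤ x + m) (sym gv≡t') t≤t'+m
        , subst (_< t) (sym gv≡t') (n<1+n t')))
      where
      t≤t'+m : t ≤ t' + m
      t≤t'+m = ≤-trans (≤-reflexive (+-comm 1 t')) (+-monoʳ-≤ t' 1≤m)

    height-small : SmallNear (suc m) (height m g t) c₀
    height-small k k<n (inj₁ refl) = count≤1 (λ i → g i c₀ <? t) (suc m)
      (λ i i' i<n i'<n lt lt' → trans (only-v-below-t-in-c₀ i<n lt) (sym (only-v-below-t-in-c₀ i'<n lt')))
    height-small k k<n (inj₂ beside) = count≤1 (λ i → g i k <? t) (suc m)
      (λ i₁ i₂ i₁<n i₂<n lt₁ lt₂ → sym (same-row i₁<n lt₁ i₂<n lt₂))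
      where
      k≢c₀ : k ≢ c₀
      k≢c₀ refl = [ 1+n≢n , (λ eq → 1+n≢n (sym eq)) ]′ beside
      -- Rows below t in column k sit below t' there, hence in the window [t', t' + m) in column c₀.
      c₀-window : ∀ {i} → i < suc m → g i k < t → InWindow m (t' + m) (g i c₀)
      c₀-window i<n lt = +-monoˡ-≤ m (c₀-empty _ i<n) ,
        ≤-<-trans (row-close i<n k<n c₀<n (near-sym (inj₂ beside))) (+-monoˡ-< m (below-t' i<n k<n k≢c₀ lt))
      same-row : ∀ {i₁ i₂} → i₁ < suc m → g i₁ k < t → i₂ < suc m → g i₂ k < t → i₂ ≡ i₁
      same-row {i₁} {i₂} i₁<n lt₁ i₂<n lt₂ =
        trans (proj₂ (window-filled B c (t' + m) w filled i₂<n c₀<n (c₀-window i₂<n lt₂))) w-c₀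
        where
        pick : ∀ j → Dec (j ≡ c₀) → ℕ
        pick j (yes _) = i₁
        pick j (no _) = cross-out j
        w : ℕ → ℕ
        w j = pick j (j ≟ c₀)
        w-c₀ : w c₀ ≡ i₁
        w-c₀ with c₀ ≟ c₀
        ... | yes _ = refl
        ... | no c₀≢c₀ = contradiction refl c₀≢c₀
        filled : ∀ j → j < suc m → j ≢ c → w j < suc m × InWindow m (t' + m) (g (w j) j)
        filled j j<n j≢c with j ≟ c₀
        ... | yes refl = i₁<n , c₀-window i₁<n lt₁
        ... | no j≢c₀ = cross-out<n j<n , +-monoˡ-≤ m (≤-trans (n≤1+n t') (cross-out-above j<n)) ,
          ≤-<-trans (proj₁ (cross-close j<n (off-col j≢c)))
                    (+-monoˡ-< m (below-t' (cross-in<n j<n) j<n j≢c₀ (cross-in-below j<n)))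

    cut : ColumnCut m g e t
    cut = record
      { col = c ; row = cross-row c ; inner = cross-in c ; outer = cross-out c
      ; col<n = c<n ; row+1<n = proj₁ (crossing-at-spec c<n) ; deleted = deleted
      ; endpoints = proj₁ (proj₂ (crossing-at-spec c<n)) ; inner-below = cross-in-below c<n
      ; sparse = c₀ ; sparse<n = c₀<n ; sparse≢col = c₀≢c
      ; height-small = height-small ; height-lipschitz = height-lipschitz
      ; rows-near-col = rows-near-col ; above-everywhere = above-everywhere
      ; top = cross-out ; window-above = window-above }

  column-cut : ColumnCut m g e t
  column-cut with anyUpTo? (λ j → e ≟ᵉ vert (cross-row j) j) (suc m)
  ... | yes (c , c<n , deleted) = AtDeletedColumn.cut c c<n deleted
  ... | no none = ⊥-elim (no-deleted-crossing λ j j<n eq → none (j , j<n , eq))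

endpoints-other : ∀ {x a b a' b'} → Endpoints x a b → Endpoints x a' b' → a' ≢ a → a' ≡ b
endpoints-other (inj₁ (refl , refl)) (inj₁ (refl , refl)) a'≢a = contradiction refl a'≢a
endpoints-other (inj₁ (refl , refl)) (inj₂ (refl , refl)) _ = refl
endpoints-other (inj₂ (refl , refl)) (inj₁ (refl , refl)) _ = refl
endpoints-other (inj₂ (refl , refl)) (inj₂ (refl , refl)) a'≢a = contradiction refl a'≢a

neighbour : ∀ {m c} → 1 ≤ m → c < suc m → ∃ λ k → k < suc m × Near k c × k ≢ c
neighbour 1≤m (s≤s z≤n) = 1 , s≤s 1≤m , inj₂ (inj₂ refl) , λ ()
neighbour _ (s≤s (s≤s k<m)) = _ , s≤s (m≤n⇒m≤1+n k<m) , inj₂ (inj₁ refl) , 1+n≢n ∘ sym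

-- The two cuts are disjoint, miss at most one vertex per column and none next to the column of e,
-- so their heights would form a ProfilePair.
module TwoCuts {m g M e} (B : Banded m g M e) (2≤m : 2 ≤ m) {tA tB' : ℕ} (A : ColumnCut m g e tA)
  (R : ColumnCut m (Reverse M g) e (suc tB')) (¬meets : ¬ MeetsAllColumns m (Reverse M g) tB') where
  open Banded B

  module A = ColumnCut A
  module R = ColumnCut R
  tB : ℕ
  tB = suc tB'
  c : ℕ
  c = A.col

  same-edge : A.row ≡ R.row × A.col ≡ R.col
  same-edge = vert-injective (trans (sym A.deleted) R.deleted)

  -- Every column has a label ≥ tA, so otherwise the reversed labels below tB' would meet every column.
  no-overlap : M < tB' + tA → ⊥
  no-overlap M<tB'+tA = ¬meets λ j j<n → below-tB' j<n (A.above-everywhere j j<n)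
    where
    below-tB' : ∀ {j} → j < suc m → (∃ λ i → i < suc m × tA ≤ g i j) → ∃ λ i → i < suc m × M ∸ g i j < tB'
    below-tB' {j} j<n (i , i<n , tA≤g) = i , i<n , +-cancelʳ-< (g i j) (M ∸ g i j) tB'
      (subst (_< tB' + g i j) (sym (m∸n+n≡m (bounded i<n j<n))) (<-≤-trans M<tB'+tA (+-monoʳ-≤ tB' tA≤g)))

  disjoint : ∀ {i j} → g i j < tA → M ∸ g i j < tB → ⊥
  disjoint {i} {j} in-A in-B = no-overlap (begin-strict
    M                   ≤⟨ m≤n+m∸n M (g i j) ⟩
    g i j + (M ∸ g i j) <⟨ +-monoʳ-< (g i j) in-B ⟩
    g i j + tB          ≡⟨ +-suc (g i j) tB' ⟩
    suc (g i j) + tB'   ≤⟨ +-monoˡ-≤ tB' in-A ⟩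
    tA + tB'            ≡⟨ +-comm tA tB' ⟩
    tB' + tA            ∎)
    where open ≤-Reasoning

  R-endpoints : Endpoints A.row R.inner R.outer
  R-endpoints = subst (λ x → Endpoints x R.inner R.outer) (sym (proj₁ same-edge)) R.endpoints

  R-inner≡A-outer : R.inner ≡ A.outer
  R-inner≡A-outer = endpoints-other A.endpoints R-endpoints λ eq →
    disjoint A.inner-below (subst₂ (λ i j → M ∸ g i j < tB) eq (sym (proj₂ same-edge)) R.inner-below)

  beside : ∃ λ k → k < suc m × Near k c × k ≢ c
  beside = neighbour (≤-trans (n≤1+n 1) 2≤m) A.col<n

  k : ℕ
  k = proj₁ beside
  k<n : k < suc m
  k<n = proj₁ (proj₂ beside)
  k-near : Near k c
  k-near = proj₁ (proj₂ (proj₂ beside))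
  k≢c : k ≢ c
  k≢c = proj₂ (proj₂ (proj₂ beside))

  near-R : ∀ {j} → Near j c → Near j R.col
  near-R {j} = subst (Near j) (proj₂ same-edge)

  inner-below-k : g A.inner k < tA
  inner-below-k = proj₂ (A.rows-near-col k k<n k-near A.inner (proj₁ (endpoints<n A.endpoints A.row+1<n))) A.inner-below

  outer-in-B-k : M ∸ g A.outer k < tB
  outer-in-B-k = proj₂ (R.rows-near-col k k<n (near-R k-near) A.outer (proj₂ (endpoints<n A.endpoints A.row+1<n)))
    (subst (λ i → M ∸ g i R.col < tB) R-inner≡A-outer R.inner-below)

  outer-close-k : g A.outer k ≤ g A.inner k + m
  outer-close-k = proj₁ (endpoints-close B A.endpoints A.row+1<n k<n
    λ eq → k≢c (sym (proj₂ (vert-injective (trans (sym A.deleted) eq)))))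

  -- Such a label is below that of the outer endpoint in column k, hence in [tA, tA + m).
  outside-both : ∀ {i j} → i < suc m → j < suc m → ¬ g i j < tA → ¬ M ∸ g i j < tB → j ≢ c × i ≡ A.top j
  outside-both {i} {j} i<n j<n ¬A ¬B = A.window-above i<n j<n (+-monoˡ-≤ m (≮⇒≥ ¬A) , (begin-strict
    g i j               <⟨ +-cancelˡ-< tB (g i j) (g A.outer k) (begin-strict
                             tB + g i j           ≤⟨ m≤o∸n⇒m+n≤o tB (bounded i<n j<n) (≮⇒≥ ¬B) ⟩
                             M                    ≤⟨ m≤n+m∸n M (g A.outer k) ⟩
                             g A.outer k + (M ∸ g A.outer k) <⟨ +-monoʳ-< (g A.outer k) outer-in-B-k ⟩
                             g A.outer k + tB     ≡⟨ +-comm (g A.outer k) tB ⟩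
                             tB + g A.outer k     ∎) ⟩
    g A.outer k         ≤⟨ outer-close-k ⟩
    g A.inner k + m     <⟨ +-monoˡ-< m inner-below-k ⟩
    tA + m              ∎))
    where open ≤-Reasoning

  A-or-B : ∀ {i j} → (¬ g i j < tA → ¬ M ∸ g i j < tB → ⊥) → g i j < tA ⊎ M ∸ g i j < tB
  A-or-B {i} {j} neither with g i j <? tA | M ∸ g i j <? tB
  ... | yes in-A | _ = inj₁ in-A
  ... | no _ | yes in-B = inj₂ in-B
  ... | no ¬A | no ¬B = ⊥-elim (neither ¬A ¬B)

  cover : ∀ q → q < suc m → m ≤ height m g tA q + height m (Reverse M g) tB q
  cover q q<n = s≤s⁻¹ (count-cover-except (λ i → g i q <? tA) (λ i → M ∸ g i q <? tB) (suc m) (A.top q)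
    λ i i<n i≢top → A-or-B λ ¬A ¬B → i≢top (proj₂ (outside-both i<n q<n ¬A ¬B)))

  cover-near : ∀ k' → k' < suc m → Near k' c → suc m ≤ height m g tA k' + height m (Reverse M g) tB k'
  cover-near k' k'<n near = count-cover (λ i → g i k' <? tA) (λ i → M ∸ g i k' <? tB) (suc m)
    λ i i<n → A-or-B λ ¬A ¬B → proj₁ (outside-both i<n A.col<n
      (λ in-A → ¬A (proj₂ (A.rows-near-col k' k'<n near i i<n) in-A))
      (λ in-B → ¬B (proj₂ (R.rows-near-col k' k'<n (near-R near) i i<n)
                      (subst (λ j → M ∸ g i j < tB) (proj₂ same-edge) in-B)))) refl

  profiles : ProfilePair m (height m g tA) (height m (Reverse M g) tB) c A.sparse R.sparse
  profiles = record
    { 2≤m = 2≤m ; c<n = A.col<n ; c₀<n = A.sparse<n ; c₁<n = R.sparse<n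
    ; c₀≢c = A.sparse≢col ; c₁≢c = λ eq → R.sparse≢col (trans eq (proj₂ same-edge))
    ; lip-h = A.height-lipschitz ; lip-H = R.height-lipschitz
    ; small-h = A.height-small ; small-H = R.height-small
    ; cover = cover ; cover-near = cover-near }

cuts-incompatible : ∀ {m g M e tA tB'} → Banded m g M e → 2 ≤ m → ColumnCut m g e tA →
  ColumnCut m (Reverse M g) e (suc tB') → ¬ MeetsAllColumns m (Reverse M g) tB' → ⊥
cuts-incompatible B 2≤m A R ¬meets = profiles-impossible (TwoCuts.profiles B 2≤m A R ¬meets)

meets-all-columns? : ∀ m g t → Dec (MeetsAllColumns m g t)
meets-all-columns? m g t = map′ (λ f j j<n → f j<n) (λ f {j} j<n → f j j<n)
  (allUpTo? (λ j → anyUpTo? (λ i → g i j <? t) (suc m)) (suc m))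

Cut : ℕ → (ℕ → ℕ → ℕ) → GridEdge → Set
Cut m g e = ∃ λ t' → ColumnCut m g e (suc t') × ¬ MeetsAllColumns m g t'

module _ {m g M e} (B : Banded m g M e) (2≤m : 2 ≤ m) where

  private
    meets? : ∀ t → Dec (MeetsAllColumns m g t ⊎ MeetsAllRows m g t)
    meets? t = meets-all-columns? m g t ⊎-dec meets-all-columns? m (Transpose g) t

    nothing-below-0 : ¬ (MeetsAllColumns m g 0 ⊎ MeetsAllRows m g 0)
    nothing-below-0 = [ (λ f → n≮0 (proj₂ (proj₂ (f 0 z<s)))) , (λ f → n≮0 (proj₂ (proj₂ (f 0 z<s)))) ]′

    everything-below-M+1 : MeetsAllColumns m g (suc M)
    everything-below-M+1 j j<n = 0 , z<s , s≤s (Banded.bounded B z<s j<n)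

  -- Cut at the first threshold at which the labels below it meet every column or every row.
  cut-or-transposed : Cut m g e ⊎ Cut m (Transpose g) (transpose-edge e)
  cut-or-transposed
    with crossing (λ t → ¬? (meets? t)) (suc M) z≤n nothing-below-0 (λ ¬meets → ¬meets (inj₁ everything-below-M+1))
  ... | t' , _ , _ , ¬meets-t' , ¬¬meets-t with decidable-stable (meets? (suc t')) ¬¬meets-t
  ...   | inj₁ cols = inj₁ (t' , CutConstruction.column-cut B 2≤m t' cols
      (¬meets-t' ∘ inj₁) (¬meets-t' ∘ inj₂) , ¬meets-t' ∘ inj₁)
  ...   | inj₂ rows = inj₂ (t' , CutConstruction.column-cut (transpose-banded B) 2≤m t' rows
      (¬meets-t' ∘ inj₂) (¬meets-t' ∘ inj₁) , ¬meets-t' ∘ inj₂)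

vert-not-transposed : ∀ {e x c x' c'} → e ≡ vert x c → transpose-edge e ≡ vert x' c' → ⊥
vert-not-transposed refl ()

banded-impossible : ∀ {m g M e} → Banded m g M e → 2 ≤ m → ⊥
banded-impossible B 2≤m with cut-or-transposed B 2≤m | cut-or-transposed (reverse-banded B) 2≤m
... | inj₁ (_ , A , _) | inj₁ (_ , R , ¬meets) = cuts-incompatible B 2≤m A R ¬meets
... | inj₂ (_ , A , _) | inj₂ (_ , R , ¬meets) = cuts-incompatible (transpose-banded B) 2≤m A R ¬meets
... | inj₁ (_ , A , _) | inj₂ (_ , R , _) = vert-not-transposed (ColumnCut.deleted A) (ColumnCut.deleted R)
... | inj₂ (_ , A , _) | inj₁ (_ , R , _) = vert-not-transposed (ColumnCut.deleted R) (ColumnCut.deleted A)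

module FromNumbering (m : ℕ) where

  -- Junk (row or column 0) outside the grid.
  fin : ℕ → Fin (suc m)
  fin i with i <? suc m
  ... | yes i<n = fromℕ< i<n
  ... | no _ = 0F

  toℕ-fin : ∀ {i} → i < suc m → toℕ (fin i) ≡ i
  toℕ-fin {i} i<n with i <? suc m
  ... | yes i<n' = toℕ-fromℕ< i<n'
  ... | no i≮n = contradiction i<n i≮n

  fin≢fin-suc : ∀ {a} → suc a < suc m → fin a ≢ fin (suc a)
  fin≢fin-suc a+1<n eq = 1+n≢n (sym (trans (sym (toℕ-fin (<-trans (n<1+n _) a+1<n))) (trans (cong toℕ eq) (toℕ-fin a+1<n))))

  step-fin : ∀ {a} → suc a < suc m → ∣ toℕ (fin a) - toℕ (fin (suc a)) ∣ ≡ 1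
  step-fin {a} a+1<n = subst₂ (λ x y → ∣ x - y ∣ ≡ 1)
      (sym (toℕ-fin (<-trans (n<1+n _) a+1<n))) (sym (toℕ-fin a+1<n)) (∣n-1+n∣≡1 a)

  labelling : Numbering (suc m) → ℕ → ℕ → ℕ
  labelling ν i j = toℕ (Bijection.to ν (fin i , fin j))

  grid-edge : Edge (suc m) → GridEdge
  grid-edge ((u , v) , inj₁ _) = horiz (toℕ (proj₁ u)) (toℕ (proj₂ u) ⊓ toℕ (proj₂ v))
  grid-edge ((u , v) , inj₂ _) = vert (toℕ (proj₁ u) ⊓ toℕ (proj₁ v)) (toℕ (proj₂ u))

  joins-vert : ∀ f {a b} → suc a < suc m → b < suc m → Joins f (fin a , fin b) (fin (suc a) , fin b) → grid-edge f ≡ vert a b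
  joins-vert (_ , inj₁ (eq , _)) a+1<n _ (inj₁ (refl , refl)) = contradiction eq (fin≢fin-suc a+1<n)
  joins-vert (_ , inj₁ (eq , _)) a+1<n _ (inj₂ (refl , refl)) = contradiction (sym eq) (fin≢fin-suc a+1<n)
  joins-vert (_ , inj₂ _) {a} {b} a+1<n b<n (inj₁ (refl , refl))
    rewrite toℕ-fin (<-trans (n<1+n _) a+1<n) | toℕ-fin a+1<n | toℕ-fin b<n
        = cong (λ x → vert x b) (m≤n⇒m⊓n≡m (n≤1+n a))
  joins-vert (_ , inj₂ _) {a} {b} a+1<n b<n (inj₂ (refl , refl))
    rewrite toℕ-fin (<-trans (n<1+n _) a+1<n) | toℕ-fin a+1<n | toℕ-fin b<n
        = cong (λ x → vert x b) (m≥n⇒m⊓n≡n (n≤1+n a))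

  joins-horiz : ∀ f {a b} → a < suc m → suc b < suc m → Joins f (fin a , fin b) (fin a , fin (suc b)) → grid-edge f ≡ horiz a b
  joins-horiz (_ , inj₂ (eq , _)) _ b+1<n (inj₁ (refl , refl)) = contradiction eq (fin≢fin-suc b+1<n)
  joins-horiz (_ , inj₂ (eq , _)) _ b+1<n (inj₂ (refl , refl)) = contradiction (sym eq) (fin≢fin-suc b+1<n)
  joins-horiz (_ , inj₁ _) {a} {b} a<n b+1<n (inj₁ (refl , refl))
    rewrite toℕ-fin (<-trans (n<1+n _) b+1<n) | toℕ-fin b+1<n | toℕ-fin a<n = cong (horiz a) (m≤n⇒m⊓n≡m (n≤1+n b))
  joins-horiz (_ , inj₁ _) {a} {b} a<n b+1<n (inj₂ (refl , refl))
    rewrite toℕ-fin (<-trans (n<1+n _) b+1<n) | toℕ-fin b+1<n | toℕ-fin a<n = cong (horiz a) (m≥n⇒m⊓n≡n (n≤1+n b))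

  -- With nothing deleted, exempting an arbitrary edge only weakens the hypothesis.
  deleted-edge : List (Edge (suc m)) → GridEdge
  deleted-edge [] = vert 0 0
  deleted-edge (f ∷ _) = grid-edge f

  kept-vert : ∀ F → length F < 2 → ∀ {a b} → suc a < suc m → b < suc m → deleted-edge F ≢ vert a b →
    ¬ Deleted F (fin a , fin b) (fin (suc a) , fin b)
  kept-vert (f ∷ []) _ a+1<n b<n ≢vert (_ , here refl , joins) = ≢vert (joins-vert f a+1<n b<n joins)
  kept-vert (_ ∷ _ ∷ _) (s≤s (s≤s ()))

  kept-horiz : ∀ F → length F < 2 → ∀ {a b} → a < suc m → suc b < suc m → deleted-edge F ≢ horiz a b →
    ¬ Deleted F (fin a , fin b) (fin a , fin (suc b))
  kept-horiz (f ∷ []) _ a<n b+1<n ≢horiz (_ , here refl , joins) = ≢horiz (joins-horiz f a<n b+1<n joins)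
  kept-horiz (_ ∷ _ ∷ _) (s≤s (s≤s ()))

  banded : ∀ ν F → length F < 2 → NumberingBW≤ F ν m → Banded m (labelling ν) (suc m * suc m) (deleted-edge F)
  banded ν F |F|<2 bw = record
    { injective = λ i<n j<n i'<n j'<n eq →
        let same = Bijection.injective ν (toℕ-injective eq) in
        trans (sym (toℕ-fin i<n)) (trans (cong (toℕ ∘ proj₁) same) (toℕ-fin i'<n)) ,
        trans (sym (toℕ-fin j<n)) (trans (cong (toℕ ∘ proj₂) same) (toℕ-fin j'<n))
    ; bounded = λ _ _ → <⇒≤ (toℕ<n _)
    ; vert-close = λ i+1<n j<n ≢vert →
        ∣-∣≤⇒close (bw _ _ (inj₂ (refl , step-fin i+1<n)) (kept-vert F |F|<2 i+1<n j<n ≢vert))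
    ; horiz-close = λ i<n j+1<n ≢horiz →
        ∣-∣≤⇒close (bw _ _ (inj₁ (refl , step-fin j+1<n)) (kept-horiz F |F|<2 i<n j+1<n ≢horiz)) }

lower-bound : ∀ m → 2 ≤ m → (F : List (Edge (suc m))) → length F < 2 → ¬ BandwidthDel≤ (suc m) F m
lower-bound m 2≤m F |F|<2 (ν , bw) = banded-impossible (FromNumbering.banded m ν F |F|<2 bw) 2≤m

-- The diagonal numbering and its relocations

-- pull a b moves the entry at position b back to position a, shifting [a, b) up by one;
-- push a b is its inverse.
pull : ℕ → ℕ → ℕ → ℕ
pull a b x with x <? a | x <? b | x ≟ b
... | yes _ | _     | _     = x
... | no _  | yes _ | _     = suc x
... | no _  | no _  | yes _ = a
... | no _  | no _  | no _  = x

push : ℕ → ℕ → ℕ → ℕ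
push a b y with y <? a | y ≟ a | y ≤? b
... | yes _ | _     | _     = y
... | no _  | yes _ | _     = b
... | no _  | no _  | yes _ = pred y
... | no _  | no _  | no _  = y

module Shift (a b : ℕ) where

  pull-below : ∀ {x} → x < a → pull a b x ≡ x
  pull-below {x} x<a with x <? a | x <? b | x ≟ b
  ... | yes _ | _ | _ = refl
  ... | no x≮a | _ | _ = contradiction x<a x≮a

  pull-between : ∀ {x} → a ≤ x → x < b → pull a b x ≡ suc x
  pull-between {x} a≤x x<b with x <? a | x <? b | x ≟ b
  ... | yes x<a | _ | _ = contradiction a≤x (<⇒≱ x<a)
  ... | no _ | yes _ | _ = refl
  ... | no _ | no x≮b | _ = contradiction x<b x≮b

  pull-at : a ≤ b → pull a b b ≡ a
  pull-at a≤b with b <? a | b <? b | b ≟ b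
  ... | yes b<a | _ | _ = contradiction a≤b (<⇒≱ b<a)
  ... | no _ | yes b<b | _ = contradiction b<b (<-irrefl refl)
  ... | no _ | no _ | yes _ = refl
  ... | no _ | no _ | no b≢b = contradiction refl b≢b

  pull-above : ∀ {x} → a ≤ b → b < x → pull a b x ≡ x
  pull-above {x} a≤b b<x with x <? a | x <? b | x ≟ b
  ... | yes _ | _ | _ = refl
  ... | no _ | yes x<b | _ = contradiction x<b (<-asym b<x)
  ... | no _ | no _ | yes refl = contradiction b<x (<-irrefl refl)
  ... | no _ | no _ | no _ = refl

  push-below : ∀ {y} → y < a → push a b y ≡ y
  push-below {y} y<a with y <? a | y ≟ a | y ≤? b
  ... | yes _ | _ | _ = refl
  ... | no y≮a | _ | _ = contradiction y<a y≮a

  push-at : push a b a ≡ b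
  push-at with a <? a | a ≟ a | a ≤? b
  ... | yes a<a | _ | _ = contradiction a<a (<-irrefl refl)
  ... | no _ | yes _ | _ = refl
  ... | no _ | no a≢a | _ = contradiction refl a≢a

  push-between : ∀ {y} → a < y → y ≤ b → push a b y ≡ pred y
  push-between {y} a<y y≤b with y <? a | y ≟ a | y ≤? b
  ... | yes y<a | _ | _ = contradiction y<a (<-asym a<y)
  ... | no _ | yes refl | _ = contradiction a<y (<-irrefl refl)
  ... | no _ | no _ | yes _ = refl
  ... | no _ | no _ | no y≰b = contradiction y≤b y≰b

  push-above : ∀ {y} → a ≤ b → b < y → push a b y ≡ y
  push-above {y} a≤b b<y with y <? a | y ≟ a | y ≤? b
  ... | yes _ | _ | _ = refl
  ... | no _ | yes refl | _ = contradiction a≤b (<⇒≱ b<y)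
  ... | no _ | no _ | yes y≤b = contradiction y≤b (<⇒≱ b<y)
  ... | no _ | no _ | no _ = refl

  push-pull : a ≤ b → ∀ x → push a b (pull a b x) ≡ x
  push-pull a≤b x with x <? a | x <? b | x ≟ b
  ... | yes x<a | _ | _ = push-below x<a
  ... | no x≮a | yes x<b | _ = push-between (s≤s (≮⇒≥ x≮a)) x<b
  ... | no _ | no _ | yes refl = push-at
  ... | no _ | no x≮b | no x≢b = push-above a≤b (≤∧≢⇒< (≮⇒≥ x≮b) (λ b≡x → x≢b (sym b≡x)))

  pull-push : a ≤ b → ∀ y → pull a b (push a b y) ≡ y
  pull-push a≤b y with y <? a | y ≟ a | y ≤? b
  ... | yes y<a | _ | _ = pull-below y<a
  ... | no _ | yes refl | _ = pull-at a≤b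
  ... | no y≮a | no y≢a | yes y≤b = pull-pred (≤∧≢⇒< (≮⇒≥ y≮a) (λ a≡y → y≢a (sym a≡y))) y≤b
    where
    pull-pred : ∀ {y} → a < y → y ≤ b → pull a b (pred y) ≡ y
    pull-pred {suc y} (s≤s a≤y) y<b = pull-between a≤y y<b
  ... | no _ | no _ | no y≰b = pull-above a≤b (≰⇒> y≰b)

  pull< : ∀ {x N} → a ≤ b → b < N → x < N → pull a b x < N
  pull< {x} a≤b b<N x<N with x <? a | x <? b | x ≟ b
  ... | yes _ | _ | _ = x<N
  ... | no _ | yes x<b | _ = ≤-<-trans x<b b<N
  ... | no _ | no _ | yes _ = ≤-<-trans a≤b b<N
  ... | no _ | no _ | no _ = x<N

  push< : ∀ {y N} → b < N → y < N → push a b y < N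
  push< {y} b<N y<N with y <? a | y ≟ a | y ≤? b
  ... | yes _ | _ | _ = y<N
  ... | no _ | yes _ | _ = b<N
  ... | no _ | no _ | yes _ = ≤-<-trans pred[n]≤n y<N
  ... | no _ | no _ | no _ = y<N

-- The vertices (a , b) of the grid [0, m]² listed diagonal by diagonal (by a + b),
-- each diagonal by decreasing a.
module Diagonals (m : ℕ) where

  size : ℕ → ℕ
  size k = suc (k ⊓ ((m + m) ∸ k))

  first : ℕ → ℕ
  first zero = 0
  first (suc k) = first k + size k

  offset : ℕ → ℕ → ℕ
  offset a b with a + b ≤? m
  ... | yes _ = b
  ... | no _ = m ∸ a

  rank : ℕ → ℕ → ℕ
  rank a b = first (a + b) + offset a b

  size-low : ∀ {k} → k ≤ m → size k ≡ suc k
  size-low {k} k≤m = cong suc (m≤n⇒m⊓n≡m (begin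
    k                 ≤⟨ k≤m ⟩
    m                 ≤⟨ m≤m+n m (m ∸ k) ⟩
    m + (m ∸ k)       ≡⟨ sym (+-∸-assoc m k≤m) ⟩
    (m + m) ∸ k       ∎))
    where open ≤-Reasoning

  high≤ : ∀ {k} → m ≤ k → (m + m) ∸ k ≤ k
  high≤ {k} m≤k = m≤n+o⇒m∸n≤o (m + m) k (+-mono-≤ m≤k m≤k)

  size-high : ∀ {k} → m ≤ k → size k ≡ suc ((m + m) ∸ k)
  size-high m≤k = cong suc (m≥n⇒m⊓n≡n (high≤ m≤k))

  offset-low : ∀ {a b} → a + b ≤ m → offset a b ≡ b
  offset-low {a} {b} a+b≤m with a + b ≤? m
  ... | yes _ = refl
  ... | no a+b≰m = contradiction a+b≤m a+b≰m

  offset-high : ∀ {a b} → a ≤ m → m ≤ a + b → offset a b ≡ m ∸ a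
  offset-high {a} {b} a≤m m≤a+b with a + b ≤? m
  ... | no _ = refl
  ... | yes a+b≤m = sym (trans (cong (_∸ a) (≤-antisym m≤a+b a+b≤m)) (m+n∸m≡n a b))

  offset<size : ∀ {a b} → a ≤ m → b ≤ m → offset a b < size (a + b)
  offset<size {a} {b} a≤m b≤m with a + b ≤? m
  ... | yes a+b≤m = subst (b <_) (sym (size-low a+b≤m)) (s≤s (m≤n+m b a))
  ... | no a+b≰m = subst (m ∸ a <_) (sym (size-high (<⇒≤ (≰⇒> a+b≰m))))
        (s≤s (subst (m ∸ a ≤_) (sym ([m+m]∸[a+b]≡[m∸a]+[m∸b] a≤m b≤m)) (m≤m+n _ _)))

  first-mono-≤ : ∀ {k k'} → k ≤ k' → first k ≤ first k'
  first-mono-≤ {k' = zero} z≤n = ≤-refl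
  first-mono-≤ {k} {suc k'} k≤1+k' with m≤n⇒m<n∨m≡n k≤1+k'
  ... | inj₂ refl = ≤-refl
  ... | inj₁ k<1+k' = ≤-trans (first-mono-≤ (s≤s⁻¹ k<1+k')) (m≤m+n (first k') (size k'))

  Block : ℕ → ℕ → Set
  Block k x = first k ≤ x × x < first (suc k)

  rank-block : ∀ {a b} → a ≤ m → b ≤ m → Block (a + b) (rank a b)
  rank-block {a} {b} a≤m b≤m = m≤m+n _ _ , +-monoʳ-< (first (a + b)) (offset<size a≤m b≤m)

  blocks-ordered : ∀ {k k' x y} → k < k' → Block k x → Block k' y → x < y
  blocks-ordered k<k' (_ , x<) (y≥ , _) = <-≤-trans x< (≤-trans (first-mono-≤ k<k') y≥)

  same-diagonal-offset : ∀ {a b a' b'} → a ≤ m → a' ≤ m → a + b ≡ a' + b' → offset a b ≡ offset a' b' → a ≡ a' × b ≡ b'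
  same-diagonal-offset {a} {b} {a'} {b'} a≤m a'≤m same-diag same-offset with ≤-total (a + b) m
  ... | inj₁ low = a≡a' , b≡b'
    where
    b≡b' : b ≡ b'
    b≡b' = trans (sym (offset-low low)) (trans same-offset (offset-low (subst (_≤ m) same-diag low)))
    a≡a' : a ≡ a'
    a≡a' = +-cancelʳ-≡ b a a' (trans same-diag (cong (a' +_) (sym b≡b')))
  ... | inj₂ high = a≡a' , +-cancelˡ-≡ a b b' (trans same-diag (cong (_+ b') (sym a≡a')))
    where
    a≡a' : a ≡ a'
    a≡a' = ∸-cancelˡ-≡ a≤m a'≤m
      (trans (sym (offset-high a≤m high)) (trans same-offset (offset-high a'≤m (subst (m ≤_) same-diag high))))

  rank-injective : ∀ {a b a' b'} → a ≤ m → b ≤ m → a' ≤ m → b' ≤ m → rank a b ≡ rank a' b' → a ≡ a' × b ≡ b'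
  rank-injective {a} {b} {a'} {b'} a≤m b≤m a'≤m b'≤m eq with <-cmp (a + b) (a' + b')
  ... | tri< lt _ _ = contradiction eq (<⇒≢ (blocks-ordered lt (rank-block a≤m b≤m) (rank-block a'≤m b'≤m)))
  ... | tri> _ _ gt = contradiction (sym eq) (<⇒≢ (blocks-ordered gt (rank-block a'≤m b'≤m) (rank-block a≤m b≤m)))
  ... | tri≈ _ same-diag _ = same-diagonal-offset a≤m a'≤m same-diag
        (+-cancelˡ-≡ (first (a + b)) _ _ (trans eq (cong (λ k → first k + offset a' b') (sym same-diag))))

  -- Closed forms for first, doubled to avoid division.
  first-low : ∀ k → k ≤ suc m → 2 * first k ≡ k * suc k
  first-low zero _ = refl
  first-low (suc k) k+1≤n = begin
    2 * (first k + size k)         ≡⟨ *-distribˡ-+ 2 (first k) (size k) ⟩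
    2 * first k + 2 * size k       ≡⟨ cong₂ _+_ (first-low k (≤-trans (n≤1+n k) k+1≤n)) (cong (2 *_) (size-low (s≤s⁻¹ k+1≤n))) ⟩
    k * suc k + 2 * suc k          ≡⟨ step k ⟩
    suc k * suc (suc k)            ∎
    where
    open ≡-Reasoning
    step : ∀ k → k * suc k + 2 * suc k ≡ suc k * suc (suc k)
    step = solve-∀

  first-high : ∀ d → d ≤ m → 2 * first (suc m + d) + d * d ≡ suc m * suc (suc m) + 2 * d * m + d
  first-high zero _ = begin
    2 * first (suc m + 0) + 0        ≡⟨ cong (λ k → 2 * first k + 0) (+-identityʳ (suc m)) ⟩
    2 * first (suc m) + 0            ≡⟨ cong (_+ 0) (first-low (suc m) ≤-refl) ⟩
    suc m * suc (suc m) + 0          ≡⟨ base m ⟩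
    suc m * suc (suc m) + 2 * 0 * m + 0 ∎
    where
    open ≡-Reasoning
    base : ∀ m → suc m * suc (suc m) + 0 ≡ suc m * suc (suc m) + 2 * 0 * m + 0
    base = solve-∀
  first-high (suc d) d+1≤m = begin
    2 * first (suc m + suc d) + suc d * suc d
      ≡⟨ cong (λ k → 2 * first k + suc d * suc d) (+-suc (suc m) d) ⟩
    2 * (first (suc m + d) + size (suc m + d)) + suc d * suc d
      ≡⟨ cong (λ s → 2 * (first (suc m + d) + s) + suc d * suc d) size≡ ⟩
    2 * (first (suc m + d) + suc r) + suc d * suc d
      ≡⟨ regroup (first (suc m + d)) r d ⟩
    (2 * first (suc m + d) + d * d) + (2 * (r + suc d) + 1)
      ≡⟨ cong₂ _+_ (first-high d (≤-trans (n≤1+n d) d+1≤m)) (cong (λ x → 2 * x + 1) (m∸n+n≡m d+1≤m)) ⟩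
    (suc m * suc (suc m) + 2 * d * m + d) + (2 * m + 1)
      ≡⟨ step m d ⟩
    suc m * suc (suc m) + 2 * suc d * m + suc d ∎
    where
    open ≡-Reasoning
    r : ℕ
    r = m ∸ suc d
    size≡ : size (suc m + d) ≡ suc r
    size≡ = trans (size-high (≤-trans (n≤1+n m) (m≤m+n (suc m) d)))
                  (cong suc (trans (cong ((m + m) ∸_) (sym (+-suc m d))) ([m+n]∸[m+o]≡n∸o m m (suc d))))
    regroup : ∀ p r d → 2 * (p + suc r) + suc d * suc d ≡ (2 * p + d * d) + (2 * (r + suc d) + 1)
    regroup = solve-∀
    step : ∀ m d → (suc m * suc (suc m) + 2 * d * m + d) + (2 * m + 1) ≡ suc m * suc (suc m) + 2 * suc d * m + suc d
    step = solve-∀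

  first[2m+1]≡n² : first (suc (m + m)) ≡ suc m * suc m
  first[2m+1]≡n² = *-cancelˡ-≡ _ _ 2 (+-cancelʳ-≡ (m * m) _ _ (trans (first-high m ≤-refl) (total m)))
    where
    total : ∀ m → suc m * suc (suc m) + 2 * m * m + m ≡ 2 * (suc m * suc m) + m * m
    total = solve-∀

  rank<n² : ∀ {a b} → a ≤ m → b ≤ m → rank a b < suc m * suc m
  rank<n² {a} {b} a≤m b≤m = subst (rank a b <_) first[2m+1]≡n²
    (<-≤-trans (proj₂ (rank-block a≤m b≤m)) (first-mono-≤ (s≤s (+-mono-≤ a≤m b≤m))))

  -- An edge between the diagonals k and k + 1 spans at most min (k + 2, 2m + 1 - k) positions.
  BlockStep : ℕ → ℕ → ℕ → Set
  BlockStep k x y = Block k x × Block (suc k) y × y ≤ x + (k + 2) × y + k ≤ x + suc (m + m)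

  private
    offset-step : ∀ {k o o'} → (suc k ≤ m × o' ≤ suc o) ⊎ (m ≤ k × k ≤ m + m × o' ≤ o) →
      size k + o' ≤ o + (k + 2) × size k + o' + k ≤ o + suc (m + m)
    offset-step {k} {o} {o'} (inj₁ (k<m , o'≤o+1)) =
      (begin
        size k + o'            ≡⟨ cong (_+ o') size≡ ⟩
        suc k + o'             ≤⟨ +-monoʳ-≤ (suc k) o'≤o+1 ⟩
        suc k + suc o          ≡⟨ eq₁ k o ⟩
        o + (k + 2)            ∎) ,
      (begin
        size k + o' + k        ≡⟨ cong (λ s → s + o' + k) size≡ ⟩
        suc k + o' + k         ≤⟨ +-monoˡ-≤ k (+-monoʳ-≤ (suc k) o'≤o+1) ⟩
        suc k + suc o + k      ≡⟨ eq₂ k o ⟩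
        o + (suc k + suc k)    ≤⟨ +-monoʳ-≤ o (+-mono-≤ k<m k<m) ⟩
        o + (m + m)            ≤⟨ +-monoʳ-≤ o (n≤1+n (m + m)) ⟩
        o + suc (m + m)        ∎)
      where
      open ≤-Reasoning
      size≡ : size k ≡ suc k
      size≡ = size-low (≤-trans (n≤1+n k) k<m)
      eq₁ : ∀ k o → suc k + suc o ≡ o + (k + 2)
      eq₁ = solve-∀
      eq₂ : ∀ k o → suc k + suc o + k ≡ o + (suc k + suc k)
      eq₂ = solve-∀
    offset-step {k} {o} {o'} (inj₂ (m≤k , k≤2m , o'≤o)) =
      (begin
        size k + o'            ≡⟨ cong (_+ o') (size-high m≤k) ⟩
        suc r + o'             ≤⟨ +-monoʳ-≤ (suc r) o'≤o ⟩
        suc r + o              ≤⟨ +-monoˡ-≤ o (s≤s (≤-trans (high≤ m≤k) (n≤1+n k))) ⟩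
        suc (suc k) + o        ≡⟨ eq₁ k o ⟩
        o + (k + 2)            ∎) ,
      (begin
        size k + o' + k        ≡⟨ cong (λ s → s + o' + k) (size-high m≤k) ⟩
        suc r + o' + k         ≤⟨ +-monoˡ-≤ k (+-monoʳ-≤ (suc r) o'≤o) ⟩
        suc r + o + k          ≡⟨ eq₂ r o k ⟩
        o + suc (r + k)        ≡⟨ cong (λ x → o + suc x) (m∸n+n≡m k≤2m) ⟩
        o + suc (m + m)        ∎)
      where
      open ≤-Reasoning
      r : ℕ
      r = (m + m) ∸ k
      eq₁ : ∀ k o → suc (suc k) + o ≡ o + (k + 2)
      eq₁ = solve-∀
      eq₂ : ∀ r o k → suc r + o + k ≡ o + suc (r + k)
      eq₂ = solve-∀

    block-step : ∀ {k o o'} → o < size k → o' < size (suc k) → (suc k ≤ m × o' ≤ suc o) ⊎ (m ≤ k × k ≤ m + m × o' ≤ o) →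
      BlockStep k (first k + o) (first (suc k) + o')
    block-step {k} {o} {o'} o<size o'<size case =
      (m≤m+n _ _ , +-monoʳ-< (first k) o<size) , (m≤m+n _ _ , +-monoʳ-< (first (suc k)) o'<size) ,
      subst₂ _≤_ (sym (+-assoc (first k) (size k) o')) (sym (+-assoc (first k) o (k + 2)))
        (+-monoʳ-≤ (first k) (proj₁ (offset-step case))) ,
      subst₂ _≤_ (regroup (first k) (size k) o' k) (sym (+-assoc (first k) o (suc (m + m))))
        (+-monoʳ-≤ (first k) (proj₂ (offset-step case)))
      where
      regroup : ∀ p s o' k → p + (s + o' + k) ≡ p + s + o' + k
      regroup = solve-∀

  rank-step-right : ∀ {a b} → a ≤ m → suc b ≤ m → BlockStep (a + b) (rank a b) (rank a (suc b))
  rank-step-right {a} {b} a≤m b+1≤m =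
    subst (λ k → BlockStep (a + b) (rank a b) (first k + offset a (suc b))) (sym (+-suc a b))
      (block-step (offset<size a≤m b≤m) (subst (λ k → offset a (suc b) < size k) (+-suc a b) (offset<size a≤m b+1≤m)) case)
    where
    b≤m : b ≤ m
    b≤m = ≤-trans (n≤1+n b) b+1≤m
    case : (suc (a + b) ≤ m × offset a (suc b) ≤ suc (offset a b))
        ⊎ (m ≤ a + b × a + b ≤ m + m × offset a (suc b) ≤ offset a b)
    case with <-≤-connex (a + b) m
    ... | inj₁ low = inj₁ (low , ≤-reflexive (trans (offset-low {a} {suc b} (subst (_≤ m) (sym (+-suc a b)) low))
                                                     (cong suc (sym (offset-low {a} {b} (<⇒≤ low))))))
    ... | inj₂ high = inj₂ (high , +-mono-≤ a≤m b≤m ,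
        ≤-reflexive (trans (offset-high {a} {suc b} a≤m (≤-trans high (+-monoʳ-≤ a (n≤1+n b))))
                                                                          (sym (offset-high {a} {b} a≤m high))))

  rank-step-down : ∀ {a b} → suc a ≤ m → b ≤ m → BlockStep (a + b) (rank a b) (rank (suc a) b)
  rank-step-down {a} {b} a+1≤m b≤m = block-step (offset<size a≤m b≤m) (offset<size a+1≤m b≤m) case
    where
    a≤m : a ≤ m
    a≤m = ≤-trans (n≤1+n a) a+1≤m
    case : (suc (a + b) ≤ m × offset (suc a) b ≤ suc (offset a b))
        ⊎ (m ≤ a + b × a + b ≤ m + m × offset (suc a) b ≤ offset a b)
    case with <-≤-connex (a + b) m
    ... | inj₁ low = inj₁ (low , ≤-trans (≤-reflexive (trans (offset-low {suc a} {b} low) (sym (offset-low {a} {b} (<⇒≤ low)))))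
        (n≤1+n _))
    ... | inj₂ high = inj₂ (high , +-mono-≤ a≤m b≤m ,
      ≤-trans (≤-reflexive (offset-high {suc a} {b} a+1≤m (≤-trans high (n≤1+n _))))
        (≤-trans (∸-monoʳ-≤ m (n≤1+n a)) (≤-reflexive (sym (offset-high {a} {b} a≤m high)))))

-- The diagonal order with two vertices relocated: the one at p₁ (the corner (m , 0)) moves back to the
-- start of diagonal m - 2, and the one at p₂ (the end of diagonal m or the start of diagonal m + 1)
-- moves forward to the end of diagonal m + 2.
module Relocated (q p₂ : ℕ)
  (p₂-low : Diagonals.first (suc (suc q)) (suc (suc (suc q))) ≤ suc p₂)
  (p₂-high : p₂ ≤ Diagonals.first (suc (suc q)) (suc (suc (suc q)))) where

  open Diagonals (suc (suc q))

  m : ℕ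
  m = suc (suc q)

  T₁ p₁ T₂ : ℕ
  T₁ = first q
  p₁ = first m
  T₂ = first (suc (suc m)) + q

  pos : ℕ → ℕ
  pos x = push p₂ T₂ (pull T₁ p₁ x)

  module S₁ = Shift T₁ p₁
  module S₂ = Shift p₂ T₂

  size-m : size m ≡ suc m
  size-m = size-low ≤-refl

  size-m+1 : size (suc m) ≡ m
  size-m+1 = trans (size-high (n≤1+n m)) (cong suc (trans (cong ((m + m) ∸_) (+-comm 1 m)) ([m+n]∸[m+o]≡n∸o m m 1)))

  size-m+2 : size (suc (suc m)) ≡ suc q
  size-m+2 = trans (size-high (≤-trans (n≤1+n m) (n≤1+n (suc m))))
                   (cong suc (trans (cong ((m + m) ∸_) (+-comm 2 m)) ([m+n]∸[m+o]≡n∸o m m 2)))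

  T₁≤p₁ : T₁ ≤ p₁
  T₁≤p₁ = first-mono-≤ (≤-trans (n≤1+n q) (n≤1+n (suc q)))

  p₁<p₂ : p₁ < p₂
  p₁<p₂ = s≤s⁻¹ (begin
    suc (suc p₁)          ≡⟨ +-comm 2 p₁ ⟩
    p₁ + 2                ≤⟨ +-monoʳ-≤ p₁ (s≤s (s≤s z≤n)) ⟩
    p₁ + suc m            ≡⟨ cong (p₁ +_) (sym size-m) ⟩
    first (suc m)         ≤⟨ p₂-low ⟩
    suc p₂                ∎)
    where open ≤-Reasoning

  p₂≤T₂ : p₂ ≤ T₂
  p₂≤T₂ = ≤-trans p₂-high (≤-trans (first-mono-≤ (n≤1+n (suc m))) (m≤m+n _ q))

  first-m+3 : first (suc (suc (suc m))) ≡ suc T₂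
  first-m+3 = trans (cong (first (suc (suc m)) +_) size-m+2) (+-suc (first (suc (suc m))) q)

  T₂<n² : T₂ < suc m * suc m
  T₂<n² = subst (T₂ <_) first[2m+1]≡n² (begin-strict
    T₂                          <⟨ n<1+n T₂ ⟩
    suc T₂                      ≡⟨ sym first-m+3 ⟩
    first (suc (suc (suc m)))   ≤⟨ first-mono-≤ (s≤s (s≤s (s≤s (m≤n+m m q)))) ⟩
    first (suc (m + m))         ∎)
    where open ≤-Reasoning

  unpos : ℕ → ℕ
  unpos z = push T₁ p₁ (pull p₂ T₂ z)

  unpos-pos : ∀ x → unpos (pos x) ≡ x
  unpos-pos x = trans (cong (push T₁ p₁) (S₂.pull-push p₂≤T₂ (pull T₁ p₁ x))) (S₁.push-pull T₁≤p₁ x)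

  pos-injective : ∀ {x y} → pos x ≡ pos y → x ≡ y
  pos-injective {x} {y} eq = trans (sym (unpos-pos x)) (trans (cong unpos eq) (unpos-pos y))

  pos<n² : ∀ {x} → x < suc m * suc m → pos x < suc m * suc m
  pos<n² x<n² = S₂.push< T₂<n² (S₁.pull< T₁≤p₁ (<-trans p₁<p₂ (≤-<-trans p₂≤T₂ T₂<n²)) x<n²)

  pos-early : ∀ {k x} → suc k ≤ q → Block k x → pos x ≡ x
  pos-early {k} {x} k<q (_ , x<) =
    trans (cong (push p₂ T₂) (S₁.pull-below x<T₁)) (S₂.push-below (<-≤-trans x<T₁ (≤-trans T₁≤p₁ (<⇒≤ p₁<p₂))))
    where
    x<T₁ : x < T₁
    x<T₁ = <-≤-trans x< (first-mono-≤ k<q)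

  pos-lifted : ∀ {k x} → q ≤ k → k < m → Block k x → pos x ≡ suc x
  pos-lifted {k} {x} q≤k k<m (x≥ , x<) =
    trans (cong (push p₂ T₂) (S₁.pull-between (≤-trans (first-mono-≤ q≤k) x≥) x<p₁)) (S₂.push-below (≤-<-trans x<p₁ p₁<p₂))
    where
    x<p₁ : x < p₁
    x<p₁ = <-≤-trans x< (first-mono-≤ k<m)

  pos-middle : ∀ {x} → Block m x → x ≢ p₁ → x ≢ p₂ → pos x ≡ x
  pos-middle (x≥ , x<) x≢p₁ x≢p₂ =
    trans (cong (push p₂ T₂) (S₁.pull-above T₁≤p₁ (≤∧≢⇒< x≥ (x≢p₁ ∘ sym))))
        (S₂.push-below (≤∧≢⇒< (s≤s⁻¹ (≤-trans x< p₂-low)) x≢p₂))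

  pos-lowered : ∀ {k x} → m < k → k ≤ suc (suc m) → Block k x → x ≢ p₂ → pos x ≡ pred x
  pos-lowered {k} {x} m<k k≤m+2 (x≥ , x<) x≢p₂ =
    trans (cong (push p₂ T₂) (S₁.pull-above T₁≤p₁ (<-≤-trans p₁<p₂ p₂≤x)))
          (S₂.push-between (≤∧≢⇒< p₂≤x (x≢p₂ ∘ sym))
              (s≤s⁻¹ (≤-trans x< (≤-trans (first-mono-≤ (s≤s k≤m+2)) (≤-reflexive first-m+3)))))
    where
    p₂≤x : p₂ ≤ x
    p₂≤x = ≤-trans p₂-high (≤-trans (first-mono-≤ m<k) x≥)

  pos-late : ∀ {k x} → suc (suc (suc m)) ≤ k → Block k x → pos x ≡ x
  pos-late {k} {x} m+3≤k (x≥ , _) =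
    trans (cong (push p₂ T₂) (S₁.pull-above T₁≤p₁ (<-trans p₁<p₂ (≤-<-trans p₂≤T₂ T₂<x)))) (S₂.push-above p₂≤T₂ T₂<x)
    where
    T₂<x : T₂ < x
    T₂<x = ≤-trans (≤-reflexive (sym first-m+3)) (≤-trans (first-mono-≤ m+3≤k) x≥)

  pos-p₁ : pos p₁ ≡ T₁
  pos-p₁ = trans (cong (push p₂ T₂) (S₁.pull-at T₁≤p₁)) (S₂.push-below (≤-<-trans T₁≤p₁ p₁<p₂))

  pos-p₂ : pos p₂ ≡ T₂
  pos-p₂ = trans (cong (push p₂ T₂) (S₁.pull-above T₁≤p₁ p₁<p₂)) S₂.push-at

  private
    close-via : ∀ {x y x' y'} → pos x ≡ x' → pos y ≡ y' → Close m x' y' → Close m (pos x) (pos y)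
    close-via refl refl c = c

    1≤first : ∀ {k} → 1 ≤ k → 1 ≤ first k
    1≤first 1≤k = first-mono-≤ 1≤k

  module _ {k x y} (step : BlockStep k x y) where
    private
      x-block : Block k x
      x-block = proj₁ step
      y-block : Block (suc k) y
      y-block = proj₁ (proj₂ step)
      y≤x+k+2 : y ≤ x + (k + 2)
      y≤x+k+2 = proj₁ (proj₂ (proj₂ step))
      y+k≤x+2m+1 : y + k ≤ x + suc (m + m)
      y+k≤x+2m+1 = proj₂ (proj₂ (proj₂ step))
      x<y : x < y
      x<y = <-≤-trans (proj₂ x-block) (proj₁ y-block)

    close-early : suc (suc k) ≤ q → Close m (pos x) (pos y)
    close-early k+2≤q = close-via (pos-early (≤-trans (n≤1+n _) k+2≤q) x-block) (pos-early k+2≤q y-block)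
      (≤-trans y≤x+k+2 (+-monoʳ-≤ x (≤-trans (≤-reflexive (+-comm k 2)) (≤-trans k+2≤q (≤-trans (n≤1+n q) (n≤1+n (suc q)))))) ,
       ≤-trans (<⇒≤ x<y) (m≤m+n y m))

    close-entering : suc k ≡ q → Close m (pos x) (pos y)
    close-entering refl = close-via (pos-early ≤-refl x-block) (pos-lifted ≤-refl (m<n⇒m<1+n (n<1+n _)) y-block)
      (≤-trans (s≤s y≤x+k+2) (≤-reflexive (shift x k)) , ≤-trans (<⇒≤ x<y) (≤-trans (n≤1+n y) (m≤m+n (suc y) m)))
      where
      shift : ∀ x k → suc (x + (k + 2)) ≡ x + suc (suc (suc k))
      shift = solve-∀

    close-lifted : k ≡ q → Close m (pos x) (pos y)
    close-lifted refl = close-via (pos-lifted ≤-refl (n≤1+n (suc q)) x-block) (pos-lifted (n≤1+n q) ≤-refl y-block)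
      (s≤s (≤-trans y≤x+k+2 (+-monoʳ-≤ x (≤-reflexive (+-comm q 2)))) , s≤s (≤-trans (<⇒≤ x<y) (m≤m+n y m)))

    close-leaving : suc k ≡ m → y ≢ p₁ → y ≢ p₂ → Close m (pos x) (pos y)
    close-leaving refl y≢p₁ y≢p₂ = close-via (pos-lifted (n≤1+n q) ≤-refl x-block) (pos-middle y-block y≢p₁ y≢p₂)
      (≤-trans y≤x+k+2 (≤-reflexive (shift x k)) , ≤-trans x<y (m≤m+n y m))
      where
      shift : ∀ x k → x + (k + 2) ≡ suc x + suc k
      shift = solve-∀

    close-middle : k ≡ m → x ≢ p₁ → x ≢ p₂ → y ≢ p₂ → Close m (pos x) (pos y)
    close-middle refl x≢p₁ x≢p₂ y≢p₂ = close-via (pos-middle x-block x≢p₁ x≢p₂) (pos-lowered (n<1+n m) (n≤1+n _) y-block y≢p₂)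
      (≤-trans (pred-mono-≤ y≤x+m+1) (≤-reflexive (cong pred (+-suc x m))) , ≤-trans (pred-mono-≤ x<y) (m≤m+n (pred y) m))
      where
      y≤x+m+1 : y ≤ x + suc m
      y≤x+m+1 = +-cancelʳ-≤ m y (x + suc m) (≤-trans y+k≤x+2m+1 (≤-reflexive (regroup x m)))
        where
        regroup : ∀ x m → x + suc (m + m) ≡ x + suc m + m
        regroup = solve-∀

    close-lowered : k ≡ suc m → x ≢ p₂ → y ≢ p₂ → Close m (pos x) (pos y)
    close-lowered refl x≢p₂ y≢p₂ =
      close-via (pos-lowered (n<1+n m) (n≤1+n _) x-block x≢p₂) (pos-lowered (≤-trans (n<1+n m) (n≤1+n _)) ≤-refl y-block y≢p₂)
        (≤-trans (pred-mono-≤ y≤x+m) (≤-reflexive (pred-+ (≤-trans (1≤first (s≤s z≤n)) (proj₁ x-block)))) ,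
         ≤-trans (pred-mono-≤ (<⇒≤ x<y)) (m≤m+n (pred y) m))
      where
      y≤x+m : y ≤ x + m
      y≤x+m = +-cancelʳ-≤ (suc m) y (x + m) (≤-trans y+k≤x+2m+1 (≤-reflexive (regroup x m)))
        where
        regroup : ∀ x m → x + suc (m + m) ≡ x + m + suc m
        regroup = solve-∀
      pred-+ : ∀ {x} → 1 ≤ x → pred (x + m) ≡ pred x + m
      pred-+ {suc x} _ = refl

    close-rising : k ≡ suc (suc m) → x ≢ p₂ → Close m (pos x) (pos y)
    close-rising refl x≢p₂ = close-via (pos-lowered (≤-trans (n<1+n m) (n≤1+n _)) ≤-refl x-block x≢p₂) (pos-late ≤-refl y-block)
      (≤-trans (pred-mono-≤ y+1≤x+m) (≤-reflexive (pred-+ (≤-trans (1≤first (s≤s z≤n)) (proj₁ x-block)))) ,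
       ≤-trans pred[n]≤n (≤-trans (<⇒≤ x<y) (m≤m+n y m)))
      where
      y+1≤x+m : suc y ≤ x + m
      y+1≤x+m = +-cancelʳ-≤ (suc m) (suc y) (x + m)
          (≤-trans (≤-reflexive (regroup₁ y m)) (≤-trans y+k≤x+2m+1 (≤-reflexive (regroup₂ x m))))
        where
        regroup₁ : ∀ y m → suc y + suc m ≡ y + suc (suc m)
        regroup₁ = solve-∀
        regroup₂ : ∀ x m → x + suc (m + m) ≡ x + m + suc m
        regroup₂ = solve-∀
      pred-+ : ∀ {x} → 1 ≤ x → pred (x + m) ≡ pred x + m
      pred-+ {suc x} _ = refl

    close-late : suc (suc (suc m)) ≤ k → Close m (pos x) (pos y)
    close-late m+3≤k = close-via (pos-late m+3≤k x-block) (pos-late (≤-trans m+3≤k (n≤1+n k)) y-block)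
      (≤-trans (m≤m+n y 2) y+2≤x+m , ≤-trans (<⇒≤ x<y) (m≤m+n y m))
      where
      y+2≤x+m : y + 2 ≤ x + m
      y+2≤x+m = +-cancelʳ-≤ (suc m) (y + 2) (x + m)
        (≤-trans (≤-reflexive (regroup₁ y m))
            (≤-trans (+-monoʳ-≤ y m+3≤k) (≤-trans y+k≤x+2m+1 (≤-reflexive (regroup₂ x m)))))
        where
        regroup₁ : ∀ y m → y + 2 + suc m ≡ y + suc (suc (suc m))
        regroup₁ = solve-∀
        regroup₂ : ∀ x m → x + suc (m + m) ≡ x + m + suc m
        regroup₂ = solve-∀

    close-step : x ≢ p₁ → x ≢ p₂ → y ≢ p₁ → y ≢ p₂ → Close m (pos x) (pos y)
    close-step x≢p₁ x≢p₂ y≢p₁ y≢p₂ with suc k <? q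
    ... | yes k+2≤q = close-early k+2≤q
    ... | no k+2≰q with suc k ≟ q
    ...   | yes k+1≡q = close-entering k+1≡q
    ...   | no k+1≢q with k ≟ q
    ...     | yes k≡q = close-lifted k≡q
    ...     | no k≢q with suc k ≟ m
    ...       | yes k+1≡m = close-leaving k+1≡m y≢p₁ y≢p₂
    ...       | no k+1≢m with k ≟ m
    ...         | yes k≡m = close-middle k≡m x≢p₁ x≢p₂ y≢p₂
    ...         | no k≢m with k ≟ suc m
    ...           | yes k≡m+1 = close-lowered k≡m+1 x≢p₂ y≢p₂
    ...           | no k≢m+1 with k ≟ suc (suc m)
    ...             | yes k≡m+2 = close-rising k≡m+2 x≢p₂
    ...             | no k≢m+2 = close-late m+3≤k
      where
      q+1≤k : suc q ≤ k
      q+1≤k = ≤∧≢⇒< (s≤s⁻¹ (≤∧≢⇒< (≮⇒≥ k+2≰q) (k+1≢q ∘ sym))) (k≢q ∘ sym)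
      m≤k : m ≤ k
      m≤k = ≤∧≢⇒< q+1≤k (λ q+1≡k → k+1≢m (cong suc (sym q+1≡k)))
      m+3≤k : suc (suc (suc m)) ≤ k
      m+3≤k = ≤∧≢⇒< (≤∧≢⇒< (≤∧≢⇒< m≤k (k≢m ∘ sym)) (k≢m+1 ∘ sym)) (k≢m+2 ∘ sym)

module RelocatedLayout (q wa wb : ℕ) (wa≤m : wa ≤ suc (suc q)) (wb≤m : wb ≤ suc (suc q))
  (p₂-low : Diagonals.first (suc (suc q)) (suc (suc (suc q))) ≤ suc (Diagonals.rank (suc (suc q)) wa wb))
  (p₂-high : Diagonals.rank (suc (suc q)) wa wb ≤ Diagonals.first (suc (suc q)) (suc (suc (suc q)))) where

  open Diagonals (suc (suc q))
  open Relocated q (rank wa wb) p₂-low p₂-high public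

  layout : ℕ → ℕ → ℕ
  layout a b = pos (rank a b)

  layout<n² : ∀ {a b} → a ≤ m → b ≤ m → layout a b < suc m * suc m
  layout<n² a≤m b≤m = pos<n² (rank<n² a≤m b≤m)

  layout-injective : ∀ {a b a' b'} → a ≤ m → b ≤ m → a' ≤ m → b' ≤ m → layout a b ≡ layout a' b' → a ≡ a' × b ≡ b'
  layout-injective a≤m b≤m a'≤m b'≤m eq = rank-injective a≤m b≤m a'≤m b'≤m (pos-injective eq)

  Unmoved : ℕ → ℕ → Set
  Unmoved a c = ¬ (a ≡ m × c ≡ 0) × ¬ (a ≡ wa × c ≡ wb)

  p₁≡rank : rank m 0 ≡ p₁
  p₁≡rank = trans (cong (λ k → first k + offset m 0) (+-identityʳ m))
      (trans (cong (p₁ +_) (offset-low {m} {0} (≤-reflexive (+-identityʳ m)))) (+-identityʳ p₁))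

  unmoved-rank : ∀ {a c} → a ≤ m → c ≤ m → Unmoved a c → rank a c ≢ p₁ × rank a c ≢ rank wa wb
  unmoved-rank a≤m c≤m (≢corner , ≢w) =
    (λ eq → ≢corner (rank-injective a≤m c≤m ≤-refl z≤n (trans eq (sym p₁≡rank)))) ,
    (λ eq → ≢w (rank-injective a≤m c≤m wa≤m wb≤m eq))

  close-unmoved : ∀ {a c a' c' k} → a ≤ m → c ≤ m → a' ≤ m → c' ≤ m → Unmoved a c → Unmoved a' c' →
    BlockStep k (rank a c) (rank a' c') → ∣ layout a c - layout a' c' ∣ ≤ m
  close-unmoved {a} {c} {a'} {c'} a≤m c≤m a'≤m c'≤m unmoved unmoved' step =
    close⇒∣-∣≤ (close-step step (proj₁ x-fixed) (proj₂ x-fixed) (proj₁ y-fixed) (proj₂ y-fixed))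
    where
    x-fixed : rank a c ≢ p₁ × rank a c ≢ rank wa wb
    x-fixed = unmoved-rank a≤m c≤m unmoved
    y-fixed : rank a' c' ≢ p₁ × rank a' c' ≢ rank wa wb
    y-fixed = unmoved-rank a'≤m c'≤m unmoved'

  -- The corner sits at T₁ = first q, exactly m before its neighbour (m - 1 , 0).
  close-corner : ∣ layout (suc q) 0 - layout m 0 ∣ ≤ m
  close-corner = subst₂ (λ x y → ∣ x - y ∣ ≤ m) (sym pos-upper) (sym (trans (cong pos p₁≡rank) pos-p₁))
    (close⇒∣-∣≤ (≤-trans (m≤m+n T₁ m) (m≤m+n (T₁ + m) m) , ≤-refl))
    where
    rank-upper : rank (suc q) 0 ≡ first (suc q)
    rank-upper = trans (cong (λ k → first k + offset (suc q) 0) (+-identityʳ (suc q)))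
      (trans (cong (first (suc q) +_) (offset-low {suc q} {0} (≤-trans (≤-reflexive (+-identityʳ (suc q))) (n≤1+n _))))
        (+-identityʳ _))
    pos-upper : layout (suc q) 0 ≡ T₁ + m
    pos-upper = trans (cong pos rank-upper) (trans (pos-lifted (n≤1+n q) ≤-refl (≤-refl , m<m+n (first (suc q)) (s≤s z≤n)))
      (trans (cong (λ s → suc (T₁ + s)) (size-low (≤-trans (n≤1+n q) (n≤1+n (suc q))))) (sym (+-suc T₁ (suc q)))))

module LayoutA (q : ℕ) where

  open Diagonals (suc (suc q))

  rank-top≡ : rank 0 (suc (suc q)) ≡ first (suc (suc q)) + suc (suc q)
  rank-top≡ = cong (first (suc (suc q)) +_) (offset-low {0} {suc (suc q)} ≤-refl)

  top-low : first (suc (suc (suc q))) ≤ suc (rank 0 (suc (suc q)))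
  top-low = ≤-reflexive (trans (cong (first (suc (suc q)) +_) (size-low ≤-refl)) (trans (+-suc _ _) (cong suc (sym rank-top≡))))

  top-high : rank 0 (suc (suc q)) ≤ first (suc (suc (suc q)))
  top-high = ≤-trans (≤-reflexive rank-top≡) (+-monoʳ-≤ (first (suc (suc q))) (≤-trans (n≤1+n _) (≤-reflexive (sym (size-low ≤-refl)))))

  open RelocatedLayout q 0 (suc (suc q)) z≤n ≤-refl top-low top-high public

  -- The opposite corner sits at T₂, exactly m after its neighbour (1 , m),
  -- which moves down to first (m + 1) + q.
  close-top : ∣ layout 0 m - layout 1 m ∣ ≤ m
  close-top = subst₂ (λ x y → ∣ x - y ∣ ≤ m) (sym pos-p₂) (sym pos-below)
    (close⇒∣-∣≤ (≤-trans (m≤m+n _ m) (≤-trans (≤-reflexive (sym T₂≡)) (m≤m+n T₂ m)) , ≤-reflexive T₂≡))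
    where
    rank-below≡ : rank 1 m ≡ first (suc m) + suc q
    rank-below≡ = cong (first (suc m) +_) (offset-high {1} {m} (s≤s z≤n) (n≤1+n m))
    pos-below : layout 1 m ≡ first (suc m) + q
    pos-below = trans (pos-lowered (n<1+n m) (n≤1+n _) (rank-block (s≤s z≤n) ≤-refl)
                         (λ eq → 1+n≢0 (proj₁ (rank-injective (s≤s z≤n) ≤-refl z≤n ≤-refl eq))))
                      (trans (cong pred rank-below≡) (cong pred (+-suc (first (suc m)) q)))
    T₂≡ : T₂ ≡ first (suc m) + q + m
    T₂≡ = trans (cong (λ s → first (suc m) + s + q) size-m+1) (trans (+-assoc (first (suc m)) m q)
            (trans (cong (first (suc m) +_) (+-comm m q)) (sym (+-assoc (first (suc m)) q m))))

  DelRight : ℕ → ℕ → Set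
  DelRight a c = (a ≡ 0 × c ≡ suc q) ⊎ (a ≡ m × c ≡ 0)

  right-short : ∀ a c → a ≤ m → suc c ≤ m → ¬ DelRight a c → ∣ layout a c - layout a (suc c) ∣ ≤ m
  right-short a c a≤m c+1≤m ¬del =
    close-unmoved {a} {c} {a} {suc c} {a + c}
      a≤m (≤-trans (n≤1+n c) c+1≤m) a≤m c+1≤m unmoved unmoved' (rank-step-right a≤m c+1≤m)
    where
    unmoved : Unmoved a c
    unmoved = (λ (a≡m , c≡0) → ¬del (inj₂ (a≡m , c≡0))) , λ { (_ , refl) → 1+n≰n c+1≤m }
    unmoved' : Unmoved a (suc c)
    unmoved' = (λ { (_ , ()) }) , λ (a≡0 , c+1≡m) → ¬del (inj₁ (a≡0 , suc-injective c+1≡m))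

  down-short : ∀ a c → suc a ≤ m → c ≤ m → ∣ layout a c - layout (suc a) c ∣ ≤ m
  down-short a c a+1≤m c≤m with (a ≟ 0) ×-dec (c ≟ m) | (a ≟ suc q) ×-dec (c ≟ 0)
  ... | yes (refl , refl) | _ = close-top
  ... | no _ | yes (refl , refl) = close-corner
  ... | no ≢top | no ≢corner =
    close-unmoved {a} {c} {suc a} {c} {a + c}
      (≤-trans (n≤1+n a) a+1≤m) c≤m a+1≤m c≤m unmoved unmoved' (rank-step-down a+1≤m c≤m)
    where
    unmoved : Unmoved a c
    unmoved = (λ { (refl , _) → 1+n≰n a+1≤m }) , ≢top
    unmoved' : Unmoved (suc a) c
    unmoved' = (λ (a+1≡m , c≡0) → ≢corner (suc-injective a+1≡m , c≡0)) , λ { (() , _) }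

module LayoutC (q : ℕ) where

  open Diagonals (suc (suc q))

  rank-w≡ : rank (suc (suc q)) 1 ≡ first (suc (suc (suc q)))
  rank-w≡ = trans (cong (λ k → first k + offset (suc (suc q)) 1) (+-comm (suc (suc q)) 1))
    (trans (cong (first (suc (suc (suc q))) +_) (trans (offset-high {suc (suc q)} {1} ≤-refl (m≤m+n _ 1)) (n∸n≡0 (suc (suc q)))))
      (+-identityʳ _))

  open RelocatedLayout q (suc (suc q)) 1 ≤-refl (s≤s z≤n)
      (≤-trans (≤-reflexive (sym rank-w≡)) (n≤1+n _)) (≤-reflexive rank-w≡) public

  -- The moved vertex sits at T₂, within m - 1 of its neighbour (m , 2),
  -- which moves down to just before first (m + 2).
  close-moved-right : ∣ layout m 1 - layout m 2 ∣ ≤ m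
  close-moved-right = subst₂ (λ x y → ∣ x - y ∣ ≤ m) (sym pos-p₂) (sym pos-right)
    (close⇒∣-∣≤ (≤-trans pred[n]≤n (≤-trans (m≤m+n _ q) (m≤m+n T₂ m)) , T₂≤))
    where
    F : ℕ
    F = first (suc (suc m))
    1≤F : 1 ≤ F
    1≤F = first-mono-≤ (s≤s z≤n)
    rank-right≡ : rank m 2 ≡ F
    rank-right≡ = trans (cong (λ k → first k + offset m 2) (+-comm m 2))
      (trans (cong (F +_) (trans (offset-high {m} {2} ≤-refl (m≤m+n m 2)) (n∸n≡0 m))) (+-identityʳ F))
    pos-right : layout m 2 ≡ pred F
    pos-right = trans (pos-lowered (≤-trans (n<1+n m) (n≤1+n _)) ≤-refl
        (subst (Block (suc (suc m))) (sym rank-right≡) (≤-refl , m<m+n F (s≤s z≤n)))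
                         (λ eq → 1+n≢n (suc-injective (proj₂ (rank-injective ≤-refl (s≤s (s≤s z≤n)) ≤-refl (s≤s z≤n) eq)))))
                      (cong pred rank-right≡)
    T₂≤ : T₂ ≤ pred F + m
    T₂≤ = begin
      F + q                 ≡⟨ cong (_+ q) (sym (suc-pred F {{>-nonZero 1≤F}})) ⟩
      suc (pred F) + q      ≡⟨ sym (+-suc (pred F) q) ⟩
      pred F + suc q        ≤⟨ +-monoʳ-≤ (pred F) (n≤1+n _) ⟩
      pred F + m            ∎
      where open ≤-Reasoning

  DelRight DelDown : ℕ → ℕ → Set
  DelRight a c = a ≡ m × c ≡ 0
  DelDown a c = a ≡ suc q × c ≡ 1

  right-short : ∀ a c → a ≤ m → suc c ≤ m → ¬ DelRight a c → ∣ layout a c - layout a (suc c) ∣ ≤ m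
  right-short a c a≤m c+1≤m ¬del with (a ≟ m) ×-dec (c ≟ 1)
  ... | yes (refl , refl) = close-moved-right
  ... | no ≢moved = close-unmoved {a} {c} {a} {suc c} {a + c} a≤m
      (≤-trans (n≤1+n c) c+1≤m) a≤m c+1≤m (¬del , ≢moved) unmoved' (rank-step-right a≤m c+1≤m)
    where
    unmoved' : Unmoved a (suc c)
    unmoved' = (λ { (_ , ()) }) , λ (a≡m , c+1≡1) → ¬del (a≡m , suc-injective c+1≡1)

  down-short : ∀ a c → suc a ≤ m → c ≤ m → ¬ DelDown a c → ∣ layout a c - layout (suc a) c ∣ ≤ m
  down-short a c a+1≤m c≤m ¬del with (a ≟ suc q) ×-dec (c ≟ 0)
  ... | yes (refl , refl) = close-corner
  ... | no ≢corner = close-unmoved {a} {c} {suc a} {c} {a + c}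
      (≤-trans (n≤1+n a) a+1≤m) c≤m a+1≤m c≤m unmoved unmoved' (rank-step-down a+1≤m c≤m)
    where
    unmoved : Unmoved a c
    unmoved = (λ { (refl , _) → 1+n≰n a+1≤m }) , λ { (refl , _) → 1+n≰n a+1≤m }
    unmoved' : Unmoved (suc a) c
    unmoved' = (λ (a+1≡m , c≡0) → ≢corner (suc-injective a+1≡m , c≡0)) , λ (a+1≡m , c≡1) → ¬del (suc-injective a+1≡m , c≡1)

injective⇒surjective : ∀ {N} (f : Fin N → Fin N) → Injective _≡_ _≡_ f → Surjective _≡_ _≡_ f
injective⇒surjective {suc N} f f-injective y with any? (λ x → f x ≟ᶠ y)
... | yes (x , fx≡y) = x , λ { refl → fx≡y }
... | no ∄x = ⊥-elim (<⇒notInjective (n<1+n N) skip-y-injective)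
  where
  y≢f : ∀ x → y ≢ f x
  y≢f x y≡fx = ∄x (x , sym y≡fx)
  skip-y : Fin (suc N) → Fin N
  skip-y x = punchOut (y≢f x)
  skip-y-injective : Injective _≡_ _≡_ skip-y
  skip-y-injective {x} {x'} eq = f-injective (punchOut-injective (y≢f x) (y≢f x') eq)

numbering : ∀ {n} (to : Vertex n → Fin (n * n)) → Injective _≡_ _≡_ to → Numbering n
numbering {n} to to-injective = mk⤖ (to-injective , surjective)
  where
  flat : Fin (n * n) → Fin (n * n)
  flat = to ∘ remQuot n
  flat-injective : Injective _≡_ _≡_ flat
  flat-injective {x} {y} eq =
    trans (sym (combine-remQuot {n} n x)) (trans (cong (uncurry combine) (to-injective eq)) (combine-remQuot {n} n y))
  surjective : Surjective _≡_ _≡_ to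
  surjective y with injective⇒surjective flat flat-injective y
  ... | x , flat-x≡y = remQuot n x , λ { refl → flat-x≡y refl }

deleted-sym : ∀ {n} {F : List (Edge n)} {u v} → Deleted F u v → Deleted F v u
deleted-sym (e , e∈F , joins) = e , e∈F , [ inj₂ , inj₁ ]′ joins

module NumberingFrom (m : ℕ) (f : ℕ → ℕ → ℕ)
  (f<n² : ∀ {a b} → a ≤ m → b ≤ m → f a b < suc m * suc m)
  (f-injective : ∀ {a b a' b'} → a ≤ m → b ≤ m → a' ≤ m → b' ≤ m → f a b ≡ f a' b' → a ≡ a' × b ≡ b') where

  toℕ≤m : (x : Fin (suc m)) → toℕ x ≤ m
  toℕ≤m x = s≤s⁻¹ (toℕ<n x)

  label : Vertex (suc m) → Fin (suc m * suc m)
  label (x , y) = fromℕ< (f<n² (toℕ≤m x) (toℕ≤m y))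

  toℕ-label : ∀ u → toℕ (label u) ≡ f (toℕ (proj₁ u)) (toℕ (proj₂ u))
  toℕ-label _ = toℕ-fromℕ< _

  ν : Numbering (suc m)
  ν = numbering label λ {(x , y)} {(x' , y')} eq →
    let (x≡ , y≡) = f-injective (toℕ≤m x) (toℕ≤m y) (toℕ≤m x') (toℕ≤m y')
                      (trans (sym (toℕ-label _)) (trans (cong toℕ eq) (toℕ-label _)))
    in cong₂ _,_ (toℕ-injective x≡) (toℕ-injective y≡)

  module _ (F : List (Edge (suc m))) (DelRight DelDown : ℕ → ℕ → Set)
    (right-short : ∀ a c → a ≤ m → suc c ≤ m → ¬ DelRight a c → ∣ f a c - f a (suc c) ∣ ≤ m)
    (down-short : ∀ a c → suc a ≤ m → c ≤ m → ¬ DelDown a c → ∣ f a c - f (suc a) c ∣ ≤ m)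
    (right-deleted : ∀ u v → proj₁ u ≡ proj₁ v → toℕ (proj₂ v) ≡ suc (toℕ (proj₂ u)) →
                     DelRight (toℕ (proj₁ u)) (toℕ (proj₂ u)) → Deleted F u v)
    (down-deleted : ∀ u v → proj₂ u ≡ proj₂ v → toℕ (proj₁ v) ≡ suc (toℕ (proj₁ u)) →
                    DelDown (toℕ (proj₁ u)) (toℕ (proj₂ u)) → Deleted F u v)
    where

    right-ok : ∀ u v → proj₁ u ≡ proj₁ v → toℕ (proj₂ v) ≡ suc (toℕ (proj₂ u)) → ¬ Deleted F u v → len ν u v ≤ m
    right-ok (x , y) (.x , y') refl y'≡ ¬del =
      subst (_≤ m) (sym (trans (cong₂ ∣_-_∣ (toℕ-label _) (toℕ-label _))
            (cong (λ b → ∣ f (toℕ x) (toℕ y) - f (toℕ x) b ∣) y'≡)))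
        (right-short (toℕ x) (toℕ y) (toℕ≤m x) (subst (_≤ m) y'≡ (toℕ≤m y')) (¬del ∘ right-deleted _ _ refl y'≡))

    down-ok : ∀ u v → proj₂ u ≡ proj₂ v → toℕ (proj₁ v) ≡ suc (toℕ (proj₁ u)) → ¬ Deleted F u v → len ν u v ≤ m
    down-ok (x , y) (x' , .y) refl x'≡ ¬del =
      subst (_≤ m) (sym (trans (cong₂ ∣_-_∣ (toℕ-label _) (toℕ-label _))
            (cong (λ a → ∣ f (toℕ x) (toℕ y) - f a (toℕ y) ∣) x'≡)))
        (down-short (toℕ x) (toℕ y) (subst (_≤ m) x'≡ (toℕ≤m x')) (toℕ≤m y) (¬del ∘ down-deleted _ _ refl x'≡))

    len-sym : ∀ u v → len ν u v ≡ len ν v u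
    len-sym u v = ∣-∣-comm (toℕ (Bijection.to ν u)) (toℕ (Bijection.to ν v))

    bandwidth : NumberingBW≤ F ν m
    bandwidth u v (inj₁ (x≡ , ∣Δy∣≡1)) ¬del with ∣m-n∣≡1⇒m≡1+n⊎n≡1+m ∣Δy∣≡1
    ... | inj₁ yu≡ = subst (_≤ m) (len-sym v u) (right-ok v u (sym x≡) yu≡ (¬del ∘ deleted-sym))
    ... | inj₂ yv≡ = right-ok u v x≡ yv≡ ¬del
    bandwidth u v (inj₂ (y≡ , ∣Δx∣≡1)) ¬del with ∣m-n∣≡1⇒m≡1+n⊎n≡1+m ∣Δx∣≡1
    ... | inj₁ xu≡ = subst (_≤ m) (len-sym v u) (down-ok v u (sym y≡) xu≡ (¬del ∘ deleted-sym))
    ... | inj₂ xv≡ = down-ok u v y≡ xv≡ ¬del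

    bandwidth≤ : BandwidthDel≤ (suc m) F m
    bandwidth≤ = ν , bandwidth

module Witnesses (q : ℕ) where

  m : ℕ
  m = suc (suc q)

  q+1<n : suc q < suc m
  q+1<n = m<n⇒m<1+n (n<1+n (suc q))

  last last-1 : Fin (suc m)
  last = fromℕ m
  last-1 = fromℕ< q+1<n

  toℕ-last : toℕ last ≡ m
  toℕ-last = toℕ-fromℕ m

  toℕ-last-1 : toℕ last-1 ≡ suc q
  toℕ-last-1 = toℕ-fromℕ< q+1<n

  ∣last-1-last∣≡1 : ∣ toℕ last-1 - toℕ last ∣ ≡ 1
  ∣last-1-last∣≡1 = subst₂ (λ a b → ∣ a - b ∣ ≡ 1) (sym toℕ-last-1) (sym toℕ-last) (∣n-1+n∣≡1 (suc q))

  corner-edge opposite-edge next-edge : Edge (suc m)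
  corner-edge = ((last , 0F) , (last , 1F)) , inj₁ (refl , refl)
  opposite-edge = ((0F , last-1) , (0F , last)) , inj₁ (refl , ∣last-1-last∣≡1)
  next-edge = ((last-1 , 1F) , (last , 1F)) , inj₂ (refl , ∣last-1-last∣≡1)

  vertex≡ : ∀ {u : Vertex (suc m)} {a b} → toℕ (proj₁ u) ≡ toℕ a → toℕ (proj₂ u) ≡ toℕ b → u ≡ (a , b)
  vertex≡ eq₁ eq₂ = cong₂ _,_ (toℕ-injective eq₁) (toℕ-injective eq₂)

  deleted-by : ∀ {F : List (Edge (suc m))} e → e ∈ F → ∀ {u v} → u ≡ src e → v ≡ tgt e → Deleted F u v
  deleted-by e e∈F refl refl = e , e∈F , inj₁ (refl , refl)

  module _ {F : List (Edge (suc m))} {u v : Vertex (suc m)}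
    (same-row : proj₁ u ≡ proj₁ v) (v-right : toℕ (proj₂ v) ≡ suc (toℕ (proj₂ u))) where

    corner-deleted : corner-edge ∈ F → toℕ (proj₁ u) ≡ m × toℕ (proj₂ u) ≡ 0 → Deleted F u v
    corner-deleted corner∈F (a≡m , c≡0) = deleted-by corner-edge corner∈F
      (vertex≡ (trans a≡m (sym toℕ-last)) c≡0)
      (vertex≡ (trans (cong toℕ (sym same-row)) (trans a≡m (sym toℕ-last))) (trans v-right (cong suc c≡0)))

    opposite-deleted : opposite-edge ∈ F → toℕ (proj₁ u) ≡ 0 × toℕ (proj₂ u) ≡ suc q → Deleted F u v
    opposite-deleted opposite∈F (a≡0 , c≡q+1) = deleted-by opposite-edge opposite∈F
      (vertex≡ a≡0 (trans c≡q+1 (sym toℕ-last-1)))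
      (vertex≡ (trans (cong toℕ (sym same-row)) a≡0) (trans v-right (trans (cong suc c≡q+1) (sym toℕ-last))))

  next-deleted : ∀ {F : List (Edge (suc m))} → next-edge ∈ F → ∀ (u v : Vertex (suc m)) → proj₂ u ≡ proj₂ v →
    toℕ (proj₁ v) ≡ suc (toℕ (proj₁ u)) → toℕ (proj₁ u) ≡ suc q × toℕ (proj₂ u) ≡ 1 → Deleted F u v
  next-deleted next∈F u v same-col v-below (a≡q+1 , c≡1) = deleted-by next-edge next∈F
    (vertex≡ (trans a≡q+1 (sym toℕ-last-1)) c≡1)
    (vertex≡ (trans v-below (trans (cong suc a≡q+1) (sym toℕ-last))) (trans (cong toℕ (sym same-col)) c≡1))

  0≢last : 0F ≢ last
  0≢last eq = 0≢1+n (trans (cong toℕ eq) toℕ-last)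

  apart : ¬ ShareEndpoint opposite-edge corner-edge
  apart (inj₁ eq) = 0≢last (cong proj₁ eq)
  apart (inj₂ (inj₁ eq)) = 0≢last (cong proj₁ eq)
  apart (inj₂ (inj₂ (inj₁ eq))) = 0≢last (cong proj₁ eq)
  apart (inj₂ (inj₂ (inj₂ eq))) = 0≢last (cong proj₁ eq)

  corner≢next : ¬ SameEdge corner-edge next-edge
  corner≢next (inj₁ (eq , _)) with cong proj₂ eq
  ... | ()
  corner≢next (inj₂ (eq , _)) with cong proj₂ eq
  ... | ()

  corner-next-share : ShareEndpoint corner-edge next-edge
  corner-next-share = inj₂ (inj₂ (inj₂ refl))

  module A = LayoutA q
  module C = LayoutC q

  apart-deletion : BandwidthDel≤ (suc m) (opposite-edge ∷ corner-edge ∷ []) m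
  apart-deletion = NumberingFrom.bandwidth≤ m A.layout A.layout<n² A.layout-injective _ A.DelRight (λ _ _ → ⊥)
    A.right-short (λ a c a+1≤m c≤m _ → A.down-short a c a+1≤m c≤m)
    (λ u v same-row v-right →
        [ opposite-deleted same-row v-right (here refl) , corner-deleted same-row v-right (there (here refl)) ]′)
    (λ _ _ _ _ ())

  adjacent-deletion : BandwidthDel≤ (suc m) (corner-edge ∷ next-edge ∷ []) m
  adjacent-deletion = NumberingFrom.bandwidth≤ m C.layout C.layout<n² C.layout-injective _ C.DelRight C.DelDown
    C.right-short C.down-short
    (λ u v same-row v-right → corner-deleted same-row v-right (here refl))
    (next-deleted (there (here refl)))

theorem4 : (n : ℕ) → 3 ≤ n →
    -- deleting fewer than 2 edges never brings the bandwidth down to ≤ n-1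
    ((F : List (Edge n)) → length F < 2 → ¬ BandwidthDel≤ n F (n ∸ 1))
    -- two distinct edges with a common endpoint whose deletion suffices
    × (∃₂ λ (e f : Edge n) → ¬ SameEdge e f × ShareEndpoint e f
         × BandwidthDel≤ n (e ∷ f ∷ []) (n ∸ 1))
    -- two edges with no common endpoint whose deletion suffices
    × (∃₂ λ (e f : Edge n) → ¬ ShareEndpoint e f
         × BandwidthDel≤ n (e ∷ f ∷ []) (n ∸ 1))
theorem4 (suc (suc (suc q))) (s≤s (s≤s (s≤s _))) =
  lower-bound (suc (suc q)) (s≤s (s≤s z≤n)) ,
  (corner-edge , next-edge , corner≢next , corner-next-share , adjacent-deletion) ,
  (opposite-edge , corner-edge , apart , apart-deletion)
  where open Witnesses q
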